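{- Let $N_E$ be the number of edges in $\mathcal G(n,m,p)$ with $n,m\ge3$ and $p\in(0,1)$, and let $\hat p=1-(1-p^2)^m$. Then $$\operatorname{Var}[N_E]=\binom n2\hat p(1-\hat p)+6\binom n3\Big[(1-2p^2+p^3)^m-(1-\hat p)^2\Big]$$ and $$\operatorname{Var}[N_E]\asymp n^2\hat p(1-\hat p)+n^3(1-2p^2+p^3)^m\big[1\wedge(mp^3)\big].$$ In particular, if $mp^3\le1$, then $\operatorname{Var}[N_E]\asymp n^2\hat p(1-\hat p)+n^3mp^3(1-\hat p)^2$.
   Context: Random intersection graph $\mathcal G(n,m,p)$: vertex set $\{v_1,\dots,v_n\}$, attribute set $\{a_1,\dots,a_m\}$; each vertex chooses each attribute independently with probability $p$; two distinct vertices are adjacent iff they chose a common attribute. $a\asymp b$ means $c\,b\le a\le C\,b$ for absolute constants $0<c\le C$ (independent of $n,m,p$), with $a,b>0$.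
   Formalization: The parameter p ranges only over the rationals in (0,1), and the absolute constants c and C in the ≍ bounds are taken to be rational. -}

module Defs where

open import Data.Bool using (Bool; true; false; if_then_else_; _∨_; _∧_)
open import Data.Nat as ℕ using (ℕ; zero; suc)
open import Data.Fin using (Fin; toℕ)
open import Data.Vec using (Vec; []; _∷_; lookup)
open import Data.List using (List; []; _∷_; map; concatMap; allFin; foldr)
open import Data.Nat.ListAction using () renaming (sum to sumℕ)
open import Data.Integer using (+_)
open import Data.Rational using (ℚ; 0ℚ; 1ℚ; _+_; _*_; _-_; _/_)

infixr 8 _^ℚ_
_^ℚ_ : ℚ → ℕ → ℚ
x ^ℚ zero  = 1ℚ
x ^ℚ suc k = x * (x ^ℚ k)

ℕ→ℚ : ℕ → ℚ
ℕ→ℚ k = (+ k) / 1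

sumℚ : List ℚ → ℚ
sumℚ = foldr _+_ 0ℚ

allBoolVecs : (k : ℕ) → List (Vec Bool k)
allBoolVecs zero    = [] ∷ []
allBoolVecs (suc k) = concatMap (λ v → (true ∷ v) ∷ (false ∷ v) ∷ []) (allBoolVecs k)

allVecsOf : {A : Set} → List A → (k : ℕ) → List (Vec A k)
allVecsOf xs zero    = [] ∷ []
allVecsOf xs (suc k) = concatMap (λ v → map (λ x → x ∷ v) xs) (allVecsOf xs k)

-- An outcome of G(n,m,p): row i records which attributes vertex v_i chose
-- (entry (i , a) is true iff v_i chose attribute a_a).
Config : ℕ → ℕ → Set
Config n m = Vec (Vec Bool m) n

allConfigs : (n m : ℕ) → List (Config n m)
allConfigs n m = allVecsOf (allBoolVecs m) n

rowWeight : ℚ → {m : ℕ} → Vec Bool m → ℚ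
rowWeight p []          = 1ℚ
rowWeight p (b ∷ bs)    = (if b then p else (1ℚ - p)) * rowWeight p bs

weight : ℚ → {n m : ℕ} → Config n m → ℚ
weight p []         = 1ℚ
weight p (r ∷ rs)   = rowWeight p r * weight p rs

shareAttr : {m : ℕ} → Vec Bool m → Vec Bool m → Bool
shareAttr []       []       = false
shareAttr (x ∷ xs) (y ∷ ys) = (x ∧ y) ∨ shareAttr xs ys

numEdges : {n m : ℕ} → Config n m → ℕ
numEdges {n} c =
  sumℕ (concatMap (λ i → map (λ j →
      if (toℕ i ℕ.<ᵇ toℕ j) ∧ shareAttr (lookup c i) (lookup c j) then 1 else 0)
    (allFin n)) (allFin n))

𝔼 : (n m : ℕ) → ℚ → (Config n m → ℚ) → ℚ
𝔼 n m p X = sumℚ (map (λ c → weight p c * X c) (allConfigs n m))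

VarNE : (n m : ℕ) → ℚ → ℚ
VarNE n m p =
  𝔼 n m p (λ c → ℕ→ℚ (numEdges c) * ℕ→ℚ (numEdges c))
  - (𝔼 n m p (λ c → ℕ→ℚ (numEdges c)) * 𝔼 n m p (λ c → ℕ→ℚ (numEdges c)))

phat : ℕ → ℚ → ℚ
phat m p = 1ℚ - (1ℚ - p * p) ^ℚ m

-- Reveal the vertices one at a time: if the new vertex has attribute set r and the earlier ones
-- form c, then N_E(r ∷ c) = D_r(c) + N_E(c) with D_r(c) the degree of the new vertex, and r is
-- independent of c.  Induction on n gives E N_E = C(n,2) P and
-- E N_E² = C(n,2) P + 6 C(n,3) K + 6 C(n,4) P², where P is the probability of an edge v₁v₂ and K
-- that of the cherry {v₁v₂, v₁v₃}.  Both factor over the m attributes, P = 1 - (1 - p²)^m = p̂ and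
-- K = 1 - 2 (1 - p²)^m + q^m with q = 1 - 2p² + p³, so C(n,2)² = C(n,2) + 6 C(n,3) + 6 C(n,4)
-- turns E N_E² - (E N_E)² into the variance formula.
-- For the order of magnitude only q^m - s^m, s = (1 - p²)², needs work: q - s = p³ (1 - p), and
-- Bernoulli-type bounds give q^m - s^m ≍ q^m (1 ⊓ m p³); if moreover m ≥ 3 and m p³ ≤ 1, then
-- p ≤ 7/10 and q^m ≤ (64/9) s^m, so q^m - s^m ≍ m p³ s^m.

module Submission where

open import Defs
open import Data.Nat as ℕ using (ℕ)
open import Data.Nat.Combinatorics using (_C_)
open import Data.Product using (_×_; ∃)
open import Relation.Binary.PropositionalEquality using (_≡_)
open import Data.Rational using (ℚ; 0ℚ; 1ℚ; _+_; _*_; _-_; _⊓_; _≤_; _<_)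

open import Data.Bool using (Bool; true; false; if_then_else_; _∧_; _∨_)
open import Data.Bool.Properties using (∧-comm)
open import Data.Empty using (⊥-elim)
open import Data.Fin using (Fin; toℕ) renaming (zero to fzero; suc to fsuc)
import Data.Integer as ℤ
import Data.Integer.Properties as ℤ
open import Data.List using (List; []; _∷_; map; concatMap; allFin; _++_)
open import Data.List.Properties using (map-cong; map-tabulate)
open import Data.Nat using (zero; suc)
open import Data.Nat.Combinatorics using (nC1≡n; nCk+nC[k+1]≡[n+1]C[k+1])
import Data.Nat.Coprimality as Coprime
open import Data.Nat.ListAction using () renaming (sum to sumℕ)
open import Data.Nat.ListAction.Properties using (sum-++)
open import Data.Nat.Properties using (m+[n∸m]≡n)
open import Data.Product using (_,_)
open import Data.Rational using (-_; mkℚ; _/_; ½; nonNegative; positive)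
import Data.Rational.Properties as ℚ
open import Data.Rational.Solver using (module +-*-Solver)
open import Data.Sum using ([_,_]′)
open import Data.Unit using (tt)
open import Data.Vec using (Vec; []; _∷_; lookup)
open import Relation.Binary.PropositionalEquality
  using (refl; sym; trans; cong; cong₂; subst; subst₂; module ≡-Reasoning)

open +-*-Solver using (solve; _:+_; _:*_; _:-_; :-_; con; _:=_)
open ≡-Reasoning

wsum : {A : Set} → (A → ℚ) → List A → (A → ℚ) → ℚ
wsum w xs f = sumℚ (map (λ x → w x * f x) xs)

module _ {A : Set} (w : A → ℚ) where

  wsum-cong : (xs : List A) {f g : A → ℚ} → (∀ x → f x ≡ g x) → wsum w xs f ≡ wsum w xs g
  wsum-cong []       f≗g = refl
  wsum-cong (x ∷ xs) f≗g = cong₂ (λ a b → w x * a + b) (f≗g x) (wsum-cong xs f≗g)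

  wsum-0 : (xs : List A) → wsum w xs (λ _ → 0ℚ) ≡ 0ℚ
  wsum-0 []       = refl
  wsum-0 (x ∷ xs) rewrite wsum-0 xs = trans (ℚ.+-identityʳ _) (ℚ.*-zeroʳ (w x))

  wsum-+ : (xs : List A) (f g : A → ℚ) → wsum w xs (λ x → f x + g x) ≡ wsum w xs f + wsum w xs g
  wsum-+ []       f g = sym (ℚ.+-identityˡ 0ℚ)
  wsum-+ (x ∷ xs) f g rewrite wsum-+ xs f g =
    solve 5 (λ wx fx gx Sf Sg → wx :* (fx :+ gx) :+ (Sf :+ Sg) := wx :* fx :+ Sf :+ (wx :* gx :+ Sg))
      refl (w x) (f x) (g x) (wsum w xs f) (wsum w xs g)

  wsum-*ˡ : (xs : List A) (a : ℚ) (f : A → ℚ) → wsum w xs (λ x → a * f x) ≡ a * wsum w xs f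
  wsum-*ˡ []       a f = sym (ℚ.*-zeroʳ a)
  wsum-*ˡ (x ∷ xs) a f rewrite wsum-*ˡ xs a f =
    solve 4 (λ wx a fx Sf → wx :* (a :* fx) :+ a :* Sf := a :* (wx :* fx :+ Sf)) refl (w x) a (f x) (wsum w xs f)

  wsum-*ʳ : (xs : List A) (a : ℚ) (f : A → ℚ) → wsum w xs (λ x → f x * a) ≡ wsum w xs f * a
  wsum-*ʳ xs a f = begin
    wsum w xs (λ x → f x * a) ≡⟨ wsum-cong xs (λ x → ℚ.*-comm (f x) a) ⟩
    wsum w xs (λ x → a * f x) ≡⟨ wsum-*ˡ xs a f ⟩
    a * wsum w xs f           ≡⟨ ℚ.*-comm a _ ⟩
    wsum w xs f * a           ∎

  wsum-*ʷ : (xs : List A) (a : ℚ) (f : A → ℚ) → wsum (λ x → w x * a) xs f ≡ a * wsum w xs f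
  wsum-*ʷ []       a f = sym (ℚ.*-zeroʳ a)
  wsum-*ʷ (x ∷ xs) a f rewrite wsum-*ʷ xs a f =
    solve 4 (λ wx a fx Sf → wx :* a :* fx :+ a :* Sf := a :* (wx :* fx :+ Sf)) refl (w x) a (f x) (wsum w xs f)

  wsum-neg : (xs : List A) (f : A → ℚ) → wsum w xs (λ x → - f x) ≡ - wsum w xs f
  wsum-neg []       f = refl
  wsum-neg (x ∷ xs) f rewrite wsum-neg xs f =
    solve 3 (λ wx fx Sf → wx :* (:- fx) :+ (:- Sf) := :- (wx :* fx :+ Sf)) refl (w x) (f x) (wsum w xs f)

  wsum-++ : (xs ys : List A) (f : A → ℚ) → wsum w (xs ++ ys) f ≡ wsum w xs f + wsum w ys f
  wsum-++ []       ys f = sym (ℚ.+-identityˡ _)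
  wsum-++ (x ∷ xs) ys f rewrite wsum-++ xs ys f = sym (ℚ.+-assoc (w x * f x) (wsum w xs f) (wsum w ys f))

  wsum-map : {B : Set} (h : B → A) (ys : List B) (f : A → ℚ) →
             wsum w (map h ys) f ≡ wsum (λ y → w (h y)) ys (λ y → f (h y))
  wsum-map h []       f = refl
  wsum-map h (y ∷ ys) f = cong (w (h y) * f (h y) +_) (wsum-map h ys f)

wsum-congʷ : {A : Set} {w w′ : A → ℚ} (xs : List A) (f : A → ℚ) →
             (∀ x → w x ≡ w′ x) → wsum w xs f ≡ wsum w′ xs f
wsum-congʷ []       f w≗w′ = refl
wsum-congʷ (x ∷ xs) f w≗w′ = cong₂ (λ a b → a * f x + b) (w≗w′ x) (wsum-congʷ xs f w≗w′)

wsum-swap : {A B : Set} (w : A → ℚ) (xs : List A) (v : B → ℚ) (ys : List B) (F : A → B → ℚ) →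
            wsum w xs (λ x → wsum v ys (F x)) ≡ wsum v ys (λ y → wsum w xs (λ x → F x y))
wsum-swap w []       v ys F = sym (wsum-0 v ys)
wsum-swap w (x ∷ xs) v ys F = begin
  w x * wsum v ys (F x) + wsum w xs (λ x′ → wsum v ys (F x′))
    ≡⟨ cong₂ _+_ (sym (wsum-*ˡ v ys (w x) (F x))) (wsum-swap w xs v ys F) ⟩
  wsum v ys (λ y → w x * F x y) + wsum v ys (λ y → wsum w xs (λ x′ → F x′ y))
    ≡⟨ sym (wsum-+ v ys _ _) ⟩
  wsum v ys (λ y → wsum w (x ∷ xs) (λ x′ → F x′ y)) ∎

module Expectation {A : Set} (w : A → ℚ) (xs : List A) (total : wsum w xs (λ _ → 1ℚ) ≡ 1ℚ) where

  E : (A → ℚ) → ℚ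
  E = wsum w xs

  E-cong : {f g : A → ℚ} → (∀ x → f x ≡ g x) → E f ≡ E g
  E-cong = wsum-cong w xs

  E-+ : (f g : A → ℚ) → E (λ x → f x + g x) ≡ E f + E g
  E-+ = wsum-+ w xs

  E-*ˡ : (a : ℚ) (f : A → ℚ) → E (λ x → a * f x) ≡ a * E f
  E-*ˡ = wsum-*ˡ w xs

  E-*ʳ : (a : ℚ) (f : A → ℚ) → E (λ x → f x * a) ≡ E f * a
  E-*ʳ = wsum-*ʳ w xs

  E-const : (a : ℚ) → E (λ _ → a) ≡ a
  E-const a = begin
    E (λ _ → a)        ≡⟨ E-cong (λ _ → sym (ℚ.*-identityʳ a)) ⟩
    E (λ _ → a * 1ℚ)   ≡⟨ E-*ˡ a (λ _ → 1ℚ) ⟩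
    a * E (λ _ → 1ℚ)   ≡⟨ cong (a *_) total ⟩
    a * 1ℚ             ≡⟨ ℚ.*-identityʳ a ⟩
    a                  ∎

  E-const-+ : (a : ℚ) (f : A → ℚ) → E (λ x → a + f x) ≡ a + E f
  E-const-+ a f = trans (E-+ (λ _ → a) f) (cong (_+ E f) (E-const a))

  E-+-const : (f : A → ℚ) (a : ℚ) → E (λ x → f x + a) ≡ E f + a
  E-+-const f a = trans (E-+ f (λ _ → a)) (cong (E f +_) (E-const a))

  E-linear : (a b : ℚ) (f g : A → ℚ) → E (λ x → a * f x + b * g x) ≡ a * E f + b * E g
  E-linear a b f g = trans (E-+ _ _) (cong₂ _+_ (E-*ˡ a f) (E-*ˡ b g))

  E-const-minus : (a : ℚ) (f : A → ℚ) → E (λ x → a - f x) ≡ a - E f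
  E-const-minus a f = trans (E-const-+ a (λ x → - f x)) (cong (a +_) (wsum-neg w xs f))

  E-+₄ : (f g h k : A → ℚ) → E (λ x → f x + g x + h x + k x) ≡ E f + E g + E h + E k
  E-+₄ f g h k = begin
    E (λ x → f x + g x + h x + k x)    ≡⟨ E-+ _ k ⟩
    E (λ x → f x + g x + h x) + E k    ≡⟨ cong (_+ E k) (E-+ _ h) ⟩
    E (λ x → f x + g x) + E h + E k    ≡⟨ cong (λ z → z + E h + E k) (E-+ f g) ⟩
    E f + E g + E h + E k              ∎

  E-[f+a]*[g+b] : (f g : A → ℚ) (a b : ℚ) →
                  E (λ x → (f x + a) * (g x + b)) ≡ E (λ x → f x * g x) + E f * b + a * E g + a * b
  E-[f+a]*[g+b] f g a b = begin
    E (λ x → (f x + a) * (g x + b))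
      ≡⟨ E-cong (λ x → solve 4 (λ f g a b → (f :+ a) :* (g :+ b) := f :* g :+ f :* b :+ a :* g :+ a :* b)
                               refl (f x) (g x) a b) ⟩
    E (λ x → f x * g x + f x * b + a * g x + a * b)
      ≡⟨ E-+₄ _ _ _ _ ⟩
    E (λ x → f x * g x) + E (λ x → f x * b) + E (λ x → a * g x) + E (λ _ → a * b)
      ≡⟨ cong₂ (λ u v → E (λ x → f x * g x) + u + v + E (λ _ → a * b)) (E-*ʳ b f) (E-*ˡ a g) ⟩
    E (λ x → f x * g x) + E f * b + a * E g + E (λ _ → a * b)
      ≡⟨ cong (E (λ x → f x * g x) + E f * b + a * E g +_) (E-const (a * b)) ⟩
    E (λ x → f x * g x) + E f * b + a * E g + a * b ∎

module _ {A : Set} (w : A → ℚ) (xs : List A) (W : ∀ {k} → Vec A k → ℚ)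
         (W-∷ : ∀ {k} x (v : Vec A k) → W (x ∷ v) ≡ w x * W v) where

  wsum-allVecsOf-suc : (k : ℕ) (F : Vec A (suc k) → ℚ) →
    wsum W (allVecsOf xs (suc k)) F ≡ wsum W (allVecsOf xs k) (λ v → wsum w xs (λ x → F (x ∷ v)))
  wsum-allVecsOf-suc k F = go (allVecsOf xs k)
    where
    extend : (v : Vec A k) → wsum W (map (λ x → x ∷ v) xs) F ≡ W v * wsum w xs (λ x → F (x ∷ v))
    extend v = begin
      wsum W (map (λ x → x ∷ v) xs) F                ≡⟨ wsum-map W (λ x → x ∷ v) xs F ⟩
      wsum (λ x → W (x ∷ v)) xs (λ x → F (x ∷ v))    ≡⟨ wsum-congʷ xs _ (λ x → W-∷ x v) ⟩
      wsum (λ x → w x * W v) xs (λ x → F (x ∷ v))    ≡⟨ wsum-*ʷ w xs (W v) _ ⟩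
      W v * wsum w xs (λ x → F (x ∷ v))              ∎
    go : (vs : List (Vec A k)) →
         wsum W (concatMap (λ v → map (λ x → x ∷ v) xs) vs) F ≡ wsum W vs (λ v → wsum w xs (λ x → F (x ∷ v)))
    go []       = refl
    go (v ∷ vs) = trans (wsum-++ W (map (λ x → x ∷ v) xs) _ F) (cong₂ _+_ (extend v) (go vs))

  wsum-allVecsOf-total : W [] ≡ 1ℚ → wsum w xs (λ _ → 1ℚ) ≡ 1ℚ →
                         (k : ℕ) → wsum W (allVecsOf xs k) (λ _ → 1ℚ) ≡ 1ℚ
  wsum-allVecsOf-total W[]≡1 total zero    = trans (ℚ.+-identityʳ _) (trans (ℚ.*-identityʳ (W [])) W[]≡1)
  wsum-allVecsOf-total W[]≡1 total (suc k) = begin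
    wsum W (allVecsOf xs (suc k)) (λ _ → 1ℚ)         ≡⟨ wsum-allVecsOf-suc k _ ⟩
    wsum W (allVecsOf xs k) (λ _ → wsum w xs (λ _ → 1ℚ)) ≡⟨ wsum-cong W (allVecsOf xs k) (λ _ → total) ⟩
    wsum W (allVecsOf xs k) (λ _ → 1ℚ)                ≡⟨ wsum-allVecsOf-total W[]≡1 total k ⟩
    1ℚ                                               ∎

bernoulli : ℚ → Bool → ℚ
bernoulli p b = if b then p else 1ℚ - p

bools : List Bool
bools = true ∷ false ∷ []

𝔼ᵇ : ℚ → (Bool → ℚ) → ℚ
𝔼ᵇ p = wsum (bernoulli p) bools

𝔼ᵇ-total : (p : ℚ) → 𝔼ᵇ p (λ _ → 1ℚ) ≡ 1ℚ
𝔼ᵇ-total p = solve 1 (λ p → p :* con 1ℚ :+ ((con 1ℚ :- p) :* con 1ℚ :+ con 0ℚ) := con 1ℚ) refl p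

module Bernoulli (p : ℚ) = Expectation (bernoulli p) bools (𝔼ᵇ-total p)

allBoolVecs≡allVecsOf-bools : (k : ℕ) → allBoolVecs k ≡ allVecsOf bools k
allBoolVecs≡allVecsOf-bools zero    = refl
allBoolVecs≡allVecsOf-bools (suc k) = cong (concatMap (λ v → map (λ b → b ∷ v) bools)) (allBoolVecs≡allVecsOf-bools k)

𝔼ʳ : ℚ → (m : ℕ) → (Vec Bool m → ℚ) → ℚ
𝔼ʳ p m = wsum (rowWeight p) (allBoolVecs m)

𝔼ʳ-suc : (p : ℚ) (m : ℕ) (F : Vec Bool (suc m) → ℚ) →
         𝔼ʳ p (suc m) F ≡ 𝔼ʳ p m (λ v → 𝔼ᵇ p (λ b → F (b ∷ v)))
𝔼ʳ-suc p m F = begin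
  wsum (rowWeight p) (allBoolVecs (suc m)) F
    ≡⟨ cong (λ vs → wsum (rowWeight p) vs F) (allBoolVecs≡allVecsOf-bools (suc m)) ⟩
  wsum (rowWeight p) (allVecsOf bools (suc m)) F
    ≡⟨ wsum-allVecsOf-suc (bernoulli p) bools (rowWeight p) (λ _ _ → refl) m F ⟩
  wsum (rowWeight p) (allVecsOf bools m) (λ v → 𝔼ᵇ p (λ b → F (b ∷ v)))
    ≡⟨ cong (λ vs → wsum (rowWeight p) vs (λ v → 𝔼ᵇ p (λ b → F (b ∷ v)))) (sym (allBoolVecs≡allVecsOf-bools m)) ⟩
  wsum (rowWeight p) (allBoolVecs m) (λ v → 𝔼ᵇ p (λ b → F (b ∷ v))) ∎

𝔼ʳ-total : (p : ℚ) (m : ℕ) → 𝔼ʳ p m (λ _ → 1ℚ) ≡ 1ℚ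
𝔼ʳ-total p m = trans (cong (λ vs → wsum (rowWeight p) vs (λ _ → 1ℚ)) (allBoolVecs≡allVecsOf-bools m))
  (wsum-allVecsOf-total (bernoulli p) bools (rowWeight p) (λ _ _ → refl) refl (𝔼ᵇ-total p) m)

𝔼-suc : (n m : ℕ) (p : ℚ) (F : Config (suc n) m → ℚ) →
        𝔼 (suc n) m p F ≡ 𝔼 n m p (λ c → 𝔼ʳ p m (λ r → F (r ∷ c)))
𝔼-suc n m p = wsum-allVecsOf-suc (rowWeight p) (allBoolVecs m) (weight p) (λ _ _ → refl) n

𝔼-total : (n m : ℕ) (p : ℚ) → 𝔼 n m p (λ _ → 1ℚ) ≡ 1ℚ
𝔼-total n m p = wsum-allVecsOf-total (rowWeight p) (allBoolVecs m) (weight p) (λ _ _ → refl) refl (𝔼ʳ-total p m) n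

ℕ→ℚ≡mkℚ : (k : ℕ) → ℕ→ℚ k ≡ mkℚ (ℤ.+ k) 0 (Coprime.sym (Coprime.1-coprimeTo k))
ℕ→ℚ≡mkℚ k = ℚ.↥p/↧p≡p (mkℚ (ℤ.+ k) 0 (Coprime.sym (Coprime.1-coprimeTo k)))

ℕ→ℚ-+ : (a b : ℕ) → ℕ→ℚ (a ℕ.+ b) ≡ ℕ→ℚ a + ℕ→ℚ b
ℕ→ℚ-+ a b = begin
  ℕ→ℚ (a ℕ.+ b)
    ≡⟨ cong (_/ 1) (sym (cong₂ ℤ._+_ (ℤ.*-identityʳ (ℤ.+ a)) (ℤ.*-identityʳ (ℤ.+ b)))) ⟩
  (ℤ.+ a ℤ.* ℤ.+ 1 ℤ.+ ℤ.+ b ℤ.* ℤ.+ 1) / 1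
    ≡⟨⟩
  mkℚ (ℤ.+ a) 0 (Coprime.sym (Coprime.1-coprimeTo a)) + mkℚ (ℤ.+ b) 0 (Coprime.sym (Coprime.1-coprimeTo b))
    ≡⟨ cong₂ _+_ (sym (ℕ→ℚ≡mkℚ a)) (sym (ℕ→ℚ≡mkℚ b)) ⟩
  ℕ→ℚ a + ℕ→ℚ b ∎

ℕ→ℚ-suc : (n : ℕ) → ℕ→ℚ (suc n) ≡ 1ℚ + ℕ→ℚ n
ℕ→ℚ-suc = ℕ→ℚ-+ 1

ℕ→ℚ-split : {k n : ℕ} → k ℕ.≤ n → ℕ→ℚ n ≡ ℕ→ℚ k + ℕ→ℚ (n ℕ.∸ k)
ℕ→ℚ-split {k} {n} k≤n = trans (cong ℕ→ℚ (sym (m+[n∸m]≡n k≤n))) (ℕ→ℚ-+ k (n ℕ.∸ k))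

binom : ℕ → ℕ → ℚ
binom n k = ℕ→ℚ (n C k)

binom-suc : (n k : ℕ) → binom (suc n) (suc k) ≡ binom n k + binom n (suc k)
binom-suc n k = trans (cong ℕ→ℚ (sym (nCk+nC[k+1]≡[n+1]C[k+1] n k))) (ℕ→ℚ-+ (n C k) (n C suc k))

binom-1 : (n : ℕ) → binom n 1 ≡ ℕ→ℚ n
binom-1 n = cong ℕ→ℚ (nC1≡n n)

binom-suc-2 : (n : ℕ) → binom (suc n) 2 ≡ ℕ→ℚ n + binom n 2
binom-suc-2 n = trans (binom-suc n 1) (cong (_+ binom n 2) (binom-1 n))

binom-2≡ : (n : ℕ) → binom n 2 ≡ ½ * (ℕ→ℚ n * (ℕ→ℚ n - 1ℚ))
binom-2≡ zero    = refl
binom-2≡ (suc n) = begin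
  binom (suc n) 2                            ≡⟨ binom-suc-2 n ⟩
  N + binom n 2                              ≡⟨ cong (N +_) (binom-2≡ n) ⟩
  N + ½ * (N * (N - 1ℚ))                     ≡⟨ solve 1 (λ N → let b₂ x = con ½ :* (x :* (x :- con 1ℚ))
                                                              in N :+ b₂ N := b₂ (con 1ℚ :+ N)) refl N ⟩
  ½ * ((1ℚ + N) * (1ℚ + N - 1ℚ))             ≡⟨ cong (λ z → ½ * (z * (z - 1ℚ))) (sym (ℕ→ℚ-suc n)) ⟩
  ½ * (ℕ→ℚ (suc n) * (ℕ→ℚ (suc n) - 1ℚ))     ∎
  where N = ℕ→ℚ n

binom-3≡ : (n : ℕ) → binom n 3 ≡ ℤ.+ 1 / 6 * (ℕ→ℚ n * (ℕ→ℚ n - 1ℚ) * (ℕ→ℚ n - ℕ→ℚ 2))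
binom-3≡ zero    = refl
binom-3≡ (suc n) = begin
  binom (suc n) 3                                   ≡⟨ binom-suc n 2 ⟩
  binom n 2 + binom n 3                             ≡⟨ cong₂ _+_ (binom-2≡ n) (binom-3≡ n) ⟩
  ½ * (N * (N - 1ℚ)) + ℤ.+ 1 / 6 * (N * (N - 1ℚ) * (N - ℕ→ℚ 2))
    ≡⟨ solve 1 (λ N → let b₂ x = con ½ :* (x :* (x :- con 1ℚ))
                          b₃ x = con (ℤ.+ 1 / 6) :* (x :* (x :- con 1ℚ) :* (x :- con (ℕ→ℚ 2)))
                      in b₂ N :+ b₃ N := b₃ (con 1ℚ :+ N)) refl N ⟩
  ℤ.+ 1 / 6 * ((1ℚ + N) * (1ℚ + N - 1ℚ) * (1ℚ + N - ℕ→ℚ 2))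
    ≡⟨ cong (λ z → ℤ.+ 1 / 6 * (z * (z - 1ℚ) * (z - ℕ→ℚ 2))) (sym (ℕ→ℚ-suc n)) ⟩
  ℤ.+ 1 / 6 * (ℕ→ℚ (suc n) * (ℕ→ℚ (suc n) - 1ℚ) * (ℕ→ℚ (suc n) - ℕ→ℚ 2)) ∎
  where N = ℕ→ℚ n

binom-4≡ : (n : ℕ) →
           binom n 4 ≡ ℤ.+ 1 / 24 * (ℕ→ℚ n * (ℕ→ℚ n - 1ℚ) * (ℕ→ℚ n - ℕ→ℚ 2) * (ℕ→ℚ n - ℕ→ℚ 3))
binom-4≡ zero    = refl
binom-4≡ (suc n) = begin
  binom (suc n) 4                                   ≡⟨ binom-suc n 3 ⟩
  binom n 3 + binom n 4                             ≡⟨ cong₂ _+_ (binom-3≡ n) (binom-4≡ n) ⟩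
  ℤ.+ 1 / 6 * (N * (N - 1ℚ) * (N - ℕ→ℚ 2)) + ℤ.+ 1 / 24 * (N * (N - 1ℚ) * (N - ℕ→ℚ 2) * (N - ℕ→ℚ 3))
    ≡⟨ solve 1 (λ N → let b₃ x = con (ℤ.+ 1 / 6) :* (x :* (x :- con 1ℚ) :* (x :- con (ℕ→ℚ 2)))
                          b₄ x = con (ℤ.+ 1 / 24) :* (x :* (x :- con 1ℚ) :* (x :- con (ℕ→ℚ 2)) :* (x :- con (ℕ→ℚ 3)))
                      in b₃ N :+ b₄ N := b₄ (con 1ℚ :+ N)) refl N ⟩
  ℤ.+ 1 / 24 * ((1ℚ + N) * (1ℚ + N - 1ℚ) * (1ℚ + N - ℕ→ℚ 2) * (1ℚ + N - ℕ→ℚ 3))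
    ≡⟨ cong (λ z → ℤ.+ 1 / 24 * (z * (z - 1ℚ) * (z - ℕ→ℚ 2) * (z - ℕ→ℚ 3))) (sym (ℕ→ℚ-suc n)) ⟩
  ℤ.+ 1 / 24 * (ℕ→ℚ (suc n) * (ℕ→ℚ (suc n) - 1ℚ) * (ℕ→ℚ (suc n) - ℕ→ℚ 2) * (ℕ→ℚ (suc n) - ℕ→ℚ 3)) ∎
  where N = ℕ→ℚ n

binom-2² : (n : ℕ) → binom n 2 * binom n 2 ≡ binom n 2 + ℕ→ℚ 6 * binom n 3 + ℕ→ℚ 6 * binom n 4
binom-2² n = begin
  binom n 2 * binom n 2
    ≡⟨ cong (λ b → b * b) (binom-2≡ n) ⟩
  B₂ * B₂
    ≡⟨ solve 1 (λ N → let B₂ = con ½ :* (N :* (N :- con 1ℚ))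
                          B₃ = con (ℤ.+ 1 / 6) :* (N :* (N :- con 1ℚ) :* (N :- con (ℕ→ℚ 2)))
                          B₄ = con (ℤ.+ 1 / 24) :* (N :* (N :- con 1ℚ) :* (N :- con (ℕ→ℚ 2)) :* (N :- con (ℕ→ℚ 3)))
                      in B₂ :* B₂ := B₂ :+ con (ℕ→ℚ 6) :* B₃ :+ con (ℕ→ℚ 6) :* B₄) refl N ⟩
  B₂ + ℕ→ℚ 6 * B₃ + ℕ→ℚ 6 * B₄
    ≡⟨ cong₂ (λ b₂ b₃ → b₂ + ℕ→ℚ 6 * b₃ + ℕ→ℚ 6 * B₄) (sym (binom-2≡ n)) (sym (binom-3≡ n)) ⟩
  binom n 2 + ℕ→ℚ 6 * binom n 3 + ℕ→ℚ 6 * B₄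
    ≡⟨ cong (λ b₄ → binom n 2 + ℕ→ℚ 6 * binom n 3 + ℕ→ℚ 6 * b₄) (sym (binom-4≡ n)) ⟩
  binom n 2 + ℕ→ℚ 6 * binom n 3 + ℕ→ℚ 6 * binom n 4 ∎
  where
  N  = ℕ→ℚ n
  B₂ = ½ * (N * (N - 1ℚ))
  B₃ = ℤ.+ 1 / 6 * (N * (N - 1ℚ) * (N - ℕ→ℚ 2))
  B₄ = ℤ.+ 1 / 24 * (N * (N - 1ℚ) * (N - ℕ→ℚ 2) * (N - ℕ→ℚ 3))

indicator : Bool → ℕ
indicator b = if b then 1 else 0

finSum : (n : ℕ) → (Fin n → ℕ) → ℕ
finSum n h = sumℕ (map h (allFin n))

finSum-suc : (n : ℕ) (h : Fin (suc n) → ℕ) → finSum (suc n) h ≡ h fzero ℕ.+ finSum n (λ i → h (fsuc i))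
finSum-suc n h = cong (λ hs → h fzero ℕ.+ sumℕ hs)
  (trans (map-tabulate fsuc h) (sym (map-tabulate (λ i → i) (λ i → h (fsuc i)))))

finSum-cong : (n : ℕ) {g h : Fin n → ℕ} → (∀ i → g i ≡ h i) → finSum n g ≡ finSum n h
finSum-cong n g≗h = cong sumℕ (map-cong g≗h (allFin n))

sum-concatMap : {A : Set} (f : A → List ℕ) (xs : List A) → sumℕ (concatMap f xs) ≡ sumℕ (map (λ x → sumℕ (f x)) xs)
sum-concatMap f []       = refl
sum-concatMap f (x ∷ xs) = trans (sum-++ (f x) (concatMap f xs)) (cong (sumℕ (f x) ℕ.+_) (sum-concatMap f xs))

edgeIndicator : {n m : ℕ} → Config n m → Fin n → Fin n → ℕ
edgeIndicator c i j = indicator ((toℕ i ℕ.<ᵇ toℕ j) ∧ shareAttr (lookup c i) (lookup c j))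

numEdges≡finSum² : {n m : ℕ} (c : Config n m) → numEdges c ≡ finSum n (λ i → finSum n (edgeIndicator c i))
numEdges≡finSum² {n} c = sum-concatMap _ (allFin n)

numEdges-∷ : {n m : ℕ} (r : Vec Bool m) (c : Config n m) →
             numEdges (r ∷ c) ≡ finSum n (λ j → indicator (shareAttr r (lookup c j))) ℕ.+ numEdges c
numEdges-∷ {n} r c = begin
  numEdges (r ∷ c)
    ≡⟨ numEdges≡finSum² (r ∷ c) ⟩
  finSum (suc n) (λ i → finSum (suc n) (edgeIndicator (r ∷ c) i))
    ≡⟨ finSum-suc n (λ i → finSum (suc n) (edgeIndicator (r ∷ c) i)) ⟩
  finSum (suc n) (edgeIndicator (r ∷ c) fzero) ℕ.+ finSum n (λ i → finSum (suc n) (edgeIndicator (r ∷ c) (fsuc i)))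
    ≡⟨ cong₂ ℕ._+_ (finSum-suc n (edgeIndicator (r ∷ c) fzero))
                   (finSum-cong n (λ i → finSum-suc n (edgeIndicator (r ∷ c) (fsuc i)))) ⟩
  finSum n (λ j → indicator (shareAttr r (lookup c j))) ℕ.+ finSum n (λ i → finSum n (edgeIndicator c i))
    ≡⟨ cong (finSum n (λ j → indicator (shareAttr r (lookup c j))) ℕ.+_) (sym (numEdges≡finSum² c)) ⟩
  finSum n (λ j → indicator (shareAttr r (lookup c j))) ℕ.+ numEdges c ∎

adj : {m : ℕ} → Vec Bool m → Vec Bool m → ℚ
adj r s = if shareAttr r s then 1ℚ else 0ℚ

degree : {n m : ℕ} → Vec Bool m → Config n m → ℚ
degree r []      = 0ℚ
degree r (s ∷ c) = adj r s + degree r c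

edges : {n m : ℕ} → Config n m → ℚ
edges []      = 0ℚ
edges (r ∷ c) = degree r c + edges c

ℕ→ℚ-indicator : (b : Bool) → ℕ→ℚ (indicator b) ≡ (if b then 1ℚ else 0ℚ)
ℕ→ℚ-indicator true  = refl
ℕ→ℚ-indicator false = refl

ℕ→ℚ-finSum-indicator : {n m : ℕ} (r : Vec Bool m) (c : Config n m) →
                        ℕ→ℚ (finSum n (λ j → indicator (shareAttr r (lookup c j)))) ≡ degree r c
ℕ→ℚ-finSum-indicator r []          = refl
ℕ→ℚ-finSum-indicator {suc n} r (s ∷ c) = begin
  ℕ→ℚ (finSum (suc n) (λ j → indicator (shareAttr r (lookup (s ∷ c) j))))
    ≡⟨ cong ℕ→ℚ (finSum-suc n (λ j → indicator (shareAttr r (lookup (s ∷ c) j)))) ⟩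
  ℕ→ℚ (indicator (shareAttr r s) ℕ.+ finSum n (λ j → indicator (shareAttr r (lookup c j))))
    ≡⟨ ℕ→ℚ-+ (indicator (shareAttr r s)) (finSum n (λ j → indicator (shareAttr r (lookup c j)))) ⟩
  ℕ→ℚ (indicator (shareAttr r s)) + ℕ→ℚ (finSum n (λ j → indicator (shareAttr r (lookup c j))))
    ≡⟨ cong₂ _+_ (ℕ→ℚ-indicator (shareAttr r s)) (ℕ→ℚ-finSum-indicator r c) ⟩
  adj r s + degree r c ∎

ℕ→ℚ-numEdges : {n m : ℕ} (c : Config n m) → ℕ→ℚ (numEdges c) ≡ edges c
ℕ→ℚ-numEdges []      = refl
ℕ→ℚ-numEdges {suc n} (r ∷ c) = begin
  ℕ→ℚ (numEdges (r ∷ c))              ≡⟨ cong ℕ→ℚ (numEdges-∷ r c) ⟩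
  ℕ→ℚ (d ℕ.+ numEdges c)              ≡⟨ ℕ→ℚ-+ d (numEdges c) ⟩
  ℕ→ℚ d + ℕ→ℚ (numEdges c)            ≡⟨ cong₂ _+_ (ℕ→ℚ-finSum-indicator r c) (ℕ→ℚ-numEdges c) ⟩
  degree r c + edges c                ∎
  where d = finSum n (λ j → indicator (shareAttr r (lookup c j)))

shareAttr-comm : {m : ℕ} (r s : Vec Bool m) → shareAttr r s ≡ shareAttr s r
shareAttr-comm []      []      = refl
shareAttr-comm (x ∷ r) (y ∷ s) = cong₂ _∨_ (∧-comm x y) (shareAttr-comm r s)

adj-comm : {m : ℕ} (r s : Vec Bool m) → adj r s ≡ adj s r
adj-comm r s = cong (λ b → if b then 1ℚ else 0ℚ) (shareAttr-comm r s)

adj-idem : {m : ℕ} (r s : Vec Bool m) → adj r s * adj r s ≡ adj r s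
adj-idem r s with shareAttr r s
... | true  = refl
... | false = refl

module Moments (p : ℚ) (m : ℕ) where

  Row : Set
  Row = Vec Bool m

  module V = Expectation (rowWeight p) (allBoolVecs m) (𝔼ʳ-total p m)
  module G (n : ℕ) = Expectation (weight p) (allConfigs n m) (𝔼-total n m p)

  V-swap : (F : Row → Row → ℚ) → V.E (λ r → V.E (F r)) ≡ V.E (λ s → V.E (λ r → F r s))
  V-swap = wsum-swap (rowWeight p) (allBoolVecs m) (rowWeight p) (allBoolVecs m)

  G-V-swap : (n : ℕ) (F : Config n m → Row → ℚ) → G.E n (λ c → V.E (F c)) ≡ V.E (λ r → G.E n (λ c → F c r))
  G-V-swap n = wsum-swap (weight p) (allConfigs n m) (rowWeight p) (allBoolVecs m)

  G-zero : (F : Config 0 m → ℚ) → G.E 0 F ≡ F []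
  G-zero F = trans (ℚ.+-identityʳ _) (ℚ.*-identityˡ (F []))

  G-suc : (n : ℕ) (F : Config (suc n) m → ℚ) → G.E (suc n) F ≡ G.E n (λ c → V.E (λ r → F (r ∷ c)))
  G-suc n = 𝔼-suc n m p

  adjProb : Row → ℚ
  adjProb r = V.E (adj r)

  coadjProb : Row → Row → ℚ
  coadjProb r r′ = V.E (λ s → adj r s * adj r′ s)

  pathProb : Row → ℚ
  pathProb r = V.E (λ s → adjProb s * adj r s)

  edgeProb : ℚ
  edgeProb = V.E adjProb

  cherryProb : ℚ
  cherryProb = V.E (λ r → adjProb r * adjProb r)

  coadjProb-diag : (r : Row) → coadjProb r r ≡ adjProb r
  coadjProb-diag r = V.E-cong (adj-idem r)

  E-coadjProb : (r : Row) → V.E (λ s → coadjProb s r) ≡ pathProb r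
  E-coadjProb r = begin
    V.E (λ s → V.E (λ t → adj s t * adj r t))   ≡⟨ V-swap (λ s t → adj s t * adj r t) ⟩
    V.E (λ t → V.E (λ s → adj s t * adj r t))   ≡⟨ V.E-cong (λ t → V.E-*ʳ (adj r t) (λ s → adj s t)) ⟩
    V.E (λ t → V.E (λ s → adj s t) * adj r t)   ≡⟨ V.E-cong (λ t → cong (_* adj r t) (V.E-cong (λ s → adj-comm s t))) ⟩
    pathProb r                                  ∎

  E-pathProb : V.E pathProb ≡ cherryProb
  E-pathProb = begin
    V.E (λ r → V.E (λ s → adjProb s * adj r s))   ≡⟨ V-swap (λ r s → adjProb s * adj r s) ⟩
    V.E (λ s → V.E (λ r → adjProb s * adj r s))   ≡⟨ V.E-cong (λ s → V.E-*ˡ (adjProb s) (λ r → adj r s)) ⟩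
    V.E (λ s → adjProb s * V.E (λ r → adj r s))   ≡⟨ V.E-cong (λ s → cong (adjProb s *_) (V.E-cong (λ r → adj-comm r s))) ⟩
    cherryProb                                    ∎

  E-degree : (n : ℕ) (r : Row) → G.E n (degree r) ≡ ℕ→ℚ n * adjProb r
  E-degree zero    r = trans (G-zero (degree r)) (sym (ℚ.*-zeroˡ (adjProb r)))
  E-degree (suc n) r = begin
    G.E (suc n) (degree r)                            ≡⟨ G-suc n (degree r) ⟩
    G.E n (λ c → V.E (λ s → adj r s + degree r c))    ≡⟨ G.E-cong n (λ c → V.E-+-const (adj r) (degree r c)) ⟩
    G.E n (λ c → adjProb r + degree r c)              ≡⟨ G.E-const-+ n (adjProb r) (degree r) ⟩
    adjProb r + G.E n (degree r)                      ≡⟨ cong (adjProb r +_) (E-degree n r) ⟩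
    adjProb r + ℕ→ℚ n * adjProb r                     ≡⟨ cong (_+ ℕ→ℚ n * adjProb r) (sym (ℚ.*-identityˡ (adjProb r))) ⟩
    1ℚ * adjProb r + ℕ→ℚ n * adjProb r                ≡⟨ sym (ℚ.*-distribʳ-+ (adjProb r) 1ℚ (ℕ→ℚ n)) ⟩
    (1ℚ + ℕ→ℚ n) * adjProb r                          ≡⟨ cong (_* adjProb r) (sym (ℕ→ℚ-suc n)) ⟩
    ℕ→ℚ (suc n) * adjProb r                           ∎

  E-degree*degree : (n : ℕ) (r r′ : Row) →
    G.E n (λ c → degree r c * degree r′ c) ≡ ℕ→ℚ n * coadjProb r r′ + ℕ→ℚ 2 * binom n 2 * (adjProb r * adjProb r′)
  E-degree*degree zero    r r′ = trans (G-zero (λ c → degree r c * degree r′ c))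
    (solve 2 (λ τ ππ → con 0ℚ := con 0ℚ :* τ :+ con (ℕ→ℚ 2) :* con 0ℚ :* ππ) refl (coadjProb r r′) (adjProb r * adjProb r′))
  E-degree*degree (suc n) r r′ = begin
    G.E (suc n) (λ c → degree r c * degree r′ c)
      ≡⟨ G-suc n (λ c → degree r c * degree r′ c) ⟩
    G.E n (λ c → V.E (λ s → (adj r s + degree r c) * (adj r′ s + degree r′ c)))
      ≡⟨ G.E-cong n (λ c → V.E-[f+a]*[g+b] (adj r) (adj r′) (degree r c) (degree r′ c)) ⟩
    G.E n (λ c → τ + π * degree r′ c + degree r c * π′ + degree r c * degree r′ c)
      ≡⟨ G.E-+₄ n (λ _ → τ) (λ c → π * degree r′ c) (λ c → degree r c * π′) (λ c → degree r c * degree r′ c) ⟩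
    G.E n (λ _ → τ) + G.E n (λ c → π * degree r′ c) + G.E n (λ c → degree r c * π′) + G.E n (λ c → degree r c * degree r′ c)
      ≡⟨ cong₂ _+_ (cong₂ _+_ (cong₂ _+_ (G.E-const n τ) (G.E-*ˡ n π (degree r′))) (G.E-*ʳ n π′ (degree r)))
                   (E-degree*degree n r r′) ⟩
    τ + π * G.E n (degree r′) + G.E n (degree r) * π′ + (N * τ + ℕ→ℚ 2 * binom n 2 * (π * π′))
      ≡⟨ cong₂ (λ d d′ → τ + π * d′ + d * π′ + (N * τ + ℕ→ℚ 2 * binom n 2 * (π * π′)))
               (E-degree n r) (E-degree n r′) ⟩
    τ + π * (N * π′) + N * π * π′ + (N * τ + ℕ→ℚ 2 * binom n 2 * (π * π′))
      ≡⟨ solve 5 (λ τ π π′ N B → τ :+ π :* (N :* π′) :+ N :* π :* π′ :+ (N :* τ :+ con (ℕ→ℚ 2) :* B :* (π :* π′))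
                              := (con 1ℚ :+ N) :* τ :+ con (ℕ→ℚ 2) :* (N :+ B) :* (π :* π′)) refl τ π π′ N (binom n 2) ⟩
    (1ℚ + N) * τ + ℕ→ℚ 2 * (N + binom n 2) * (π * π′)
      ≡⟨ cong₂ (λ a b → a * τ + ℕ→ℚ 2 * b * (π * π′)) (sym (ℕ→ℚ-suc n)) (sym (binom-suc-2 n)) ⟩
    ℕ→ℚ (suc n) * τ + ℕ→ℚ 2 * binom (suc n) 2 * (π * π′) ∎
    where
    τ = coadjProb r r′
    π = adjProb r
    π′ = adjProb r′
    N = ℕ→ℚ n

  E-edges : (n : ℕ) → G.E n edges ≡ binom n 2 * edgeProb
  E-edges zero    = trans (G-zero edges) (sym (ℚ.*-zeroˡ edgeProb))
  E-edges (suc n) = begin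
    G.E (suc n) edges                                ≡⟨ G-suc n edges ⟩
    G.E n (λ c → V.E (λ r → degree r c + edges c))   ≡⟨ G.E-cong n (λ c → V.E-+-const (λ r → degree r c) (edges c)) ⟩
    G.E n (λ c → V.E (λ r → degree r c) + edges c)   ≡⟨ G.E-+ n _ edges ⟩
    G.E n (λ c → V.E (λ r → degree r c)) + G.E n edges
      ≡⟨ cong₂ _+_ (G-V-swap n (λ c r → degree r c)) (E-edges n) ⟩
    V.E (λ r → G.E n (degree r)) + binom n 2 * edgeProb
      ≡⟨ cong (_+ binom n 2 * edgeProb) (trans (V.E-cong (E-degree n)) (V.E-*ˡ (ℕ→ℚ n) adjProb)) ⟩
    ℕ→ℚ n * edgeProb + binom n 2 * edgeProb          ≡⟨ sym (ℚ.*-distribʳ-+ edgeProb (ℕ→ℚ n) (binom n 2)) ⟩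
    (ℕ→ℚ n + binom n 2) * edgeProb                    ≡⟨ cong (_* edgeProb) (sym (binom-suc-2 n)) ⟩
    binom (suc n) 2 * edgeProb                        ∎

  E-edges*degree : (n : ℕ) (r : Row) →
    G.E n (λ c → edges c * degree r c) ≡ ℕ→ℚ 2 * binom n 2 * pathProb r + ℕ→ℚ 3 * binom n 3 * (edgeProb * adjProb r)
  E-edges*degree zero    r = trans (G-zero (λ c → edges c * degree r c))
    (solve 2 (λ ρ Pπ → con 0ℚ := con (ℕ→ℚ 2) :* con 0ℚ :* ρ :+ con (ℕ→ℚ 3) :* con 0ℚ :* Pπ)
       refl (pathProb r) (edgeProb * adjProb r))
  E-edges*degree (suc n) r = begin
    G.E (suc n) (λ c → edges c * degree r c)
      ≡⟨ G-suc n (λ c → edges c * degree r c) ⟩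
    G.E n (λ c → V.E (λ s → (degree s c + edges c) * (adj r s + degree r c)))
      ≡⟨ G.E-cong n (λ c → V.E-[f+a]*[g+b] (λ s → degree s c) (adj r) (edges c) (degree r c)) ⟩
    G.E n (λ c → D*adj c + D c * degree r c + edges c * π + edges c * degree r c)
      ≡⟨ G.E-+₄ n D*adj (λ c → D c * degree r c) (λ c → edges c * π) (λ c → edges c * degree r c) ⟩
    G.E n D*adj + G.E n (λ c → D c * degree r c) + G.E n (λ c → edges c * π) + G.E n (λ c → edges c * degree r c)
      ≡⟨ cong₂ _+_ (cong₂ _+_ (cong₂ _+_ E-D*adj E-D*degree) (trans (G.E-*ʳ n π edges) (cong (_* π) (E-edges n))))
                   (E-edges*degree n r) ⟩
    N * ρ + (N * ρ + ℕ→ℚ 2 * binom n 2 * (P * π)) + binom n 2 * P * π + (ℕ→ℚ 2 * binom n 2 * ρ + ℕ→ℚ 3 * binom n 3 * (P * π))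
      ≡⟨ solve 6 (λ N B₂ B₃ ρ P π → N :* ρ :+ (N :* ρ :+ con (ℕ→ℚ 2) :* B₂ :* (P :* π)) :+ B₂ :* P :* π
                                      :+ (con (ℕ→ℚ 2) :* B₂ :* ρ :+ con (ℕ→ℚ 3) :* B₃ :* (P :* π))
                                  := con (ℕ→ℚ 2) :* (N :+ B₂) :* ρ :+ con (ℕ→ℚ 3) :* (B₂ :+ B₃) :* (P :* π))
                 refl N (binom n 2) (binom n 3) ρ P π ⟩
    ℕ→ℚ 2 * (N + binom n 2) * ρ + ℕ→ℚ 3 * (binom n 2 + binom n 3) * (P * π)
      ≡⟨ cong₂ (λ a b → ℕ→ℚ 2 * a * ρ + ℕ→ℚ 3 * b * (P * π)) (sym (binom-suc-2 n)) (sym (binom-suc n 2)) ⟩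
    ℕ→ℚ 2 * binom (suc n) 2 * ρ + ℕ→ℚ 3 * binom (suc n) 3 * (P * π) ∎
    where
    N = ℕ→ℚ n
    ρ = pathProb r
    P = edgeProb
    π = adjProb r

    D : Config n m → ℚ
    D c = V.E (λ s → degree s c)

    D*adj : Config n m → ℚ
    D*adj c = V.E (λ s → degree s c * adj r s)

    E-D*adj : G.E n D*adj ≡ N * ρ
    E-D*adj = begin
      G.E n (λ c → V.E (λ s → degree s c * adj r s))
        ≡⟨ G-V-swap n (λ c s → degree s c * adj r s) ⟩
      V.E (λ s → G.E n (λ c → degree s c * adj r s))
        ≡⟨ V.E-cong (λ s → trans (G.E-*ʳ n (adj r s) (degree s)) (cong (_* adj r s) (E-degree n s))) ⟩
      V.E (λ s → N * adjProb s * adj r s)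
        ≡⟨ V.E-cong (λ s → ℚ.*-assoc N (adjProb s) (adj r s)) ⟩
      V.E (λ s → N * (adjProb s * adj r s))
        ≡⟨ V.E-*ˡ N (λ s → adjProb s * adj r s) ⟩
      N * ρ ∎

    E-D*degree : G.E n (λ c → D c * degree r c) ≡ N * ρ + ℕ→ℚ 2 * binom n 2 * (P * π)
    E-D*degree = begin
      G.E n (λ c → V.E (λ s → degree s c) * degree r c)
        ≡⟨ G.E-cong n (λ c → sym (V.E-*ʳ (degree r c) (λ s → degree s c))) ⟩
      G.E n (λ c → V.E (λ s → degree s c * degree r c))
        ≡⟨ G-V-swap n (λ c s → degree s c * degree r c) ⟩
      V.E (λ s → G.E n (λ c → degree s c * degree r c))
        ≡⟨ V.E-cong (λ s → E-degree*degree n s r) ⟩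
      V.E (λ s → N * coadjProb s r + ℕ→ℚ 2 * binom n 2 * (adjProb s * π))
        ≡⟨ V.E-linear N (ℕ→ℚ 2 * binom n 2) (λ s → coadjProb s r) (λ s → adjProb s * π) ⟩
      N * V.E (λ s → coadjProb s r) + ℕ→ℚ 2 * binom n 2 * V.E (λ s → adjProb s * π)
        ≡⟨ cong₂ (λ a b → N * a + ℕ→ℚ 2 * binom n 2 * b) (E-coadjProb r) (V.E-*ʳ π adjProb) ⟩
      N * ρ + ℕ→ℚ 2 * binom n 2 * (P * π) ∎

  E-edges² : (n : ℕ) →
    G.E n (λ c → edges c * edges c)
      ≡ binom n 2 * edgeProb + ℕ→ℚ 6 * binom n 3 * cherryProb + ℕ→ℚ 6 * binom n 4 * (edgeProb * edgeProb)
  E-edges² zero    = trans (G-zero (λ c → edges c * edges c))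
    (solve 3 (λ P K PP → con 0ℚ := con 0ℚ :* P :+ con (ℕ→ℚ 6) :* con 0ℚ :* K :+ con (ℕ→ℚ 6) :* con 0ℚ :* PP)
      refl edgeProb cherryProb (edgeProb * edgeProb))
  E-edges² (suc n) = begin
    G.E (suc n) (λ c → edges c * edges c)
      ≡⟨ G-suc n (λ c → edges c * edges c) ⟩
    G.E n (λ c → V.E (λ r → (degree r c + edges c) * (degree r c + edges c)))
      ≡⟨ G.E-cong n (λ c → V.E-[f+a]*[g+b] (λ r → degree r c) (λ r → degree r c) (edges c) (edges c)) ⟩
    G.E n (λ c → D² c + D c * edges c + edges c * D c + edges c * edges c)
      ≡⟨ G.E-+₄ n D² (λ c → D c * edges c) (λ c → edges c * D c) (λ c → edges c * edges c) ⟩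
    G.E n D² + G.E n (λ c → D c * edges c) + G.E n (λ c → edges c * D c) + G.E n (λ c → edges c * edges c)
      ≡⟨ cong₂ _+_ (cong₂ _+_ (cong₂ _+_ E-D² (trans (G.E-cong n (λ c → ℚ.*-comm (D c) (edges c))) E-edges*D)) E-edges*D)
                   (E-edges² n) ⟩
    N * P + ℕ→ℚ 2 * B₂ * K
      + (ℕ→ℚ 2 * B₂ * K + ℕ→ℚ 3 * B₃ * (P * P))
      + (ℕ→ℚ 2 * B₂ * K + ℕ→ℚ 3 * B₃ * (P * P))
      + (B₂ * P + ℕ→ℚ 6 * B₃ * K + ℕ→ℚ 6 * B₄ * (P * P))
      ≡⟨ solve 6 (λ N B₂ B₃ B₄ P K →
                    N :* P :+ con (ℕ→ℚ 2) :* B₂ :* K :+ (con (ℕ→ℚ 2) :* B₂ :* K :+ con (ℕ→ℚ 3) :* B₃ :* (P :* P))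
                      :+ (con (ℕ→ℚ 2) :* B₂ :* K :+ con (ℕ→ℚ 3) :* B₃ :* (P :* P))
                      :+ (B₂ :* P :+ con (ℕ→ℚ 6) :* B₃ :* K :+ con (ℕ→ℚ 6) :* B₄ :* (P :* P))
                  := (N :+ B₂) :* P :+ con (ℕ→ℚ 6) :* (B₂ :+ B₃) :* K :+ con (ℕ→ℚ 6) :* (B₃ :+ B₄) :* (P :* P))
                 refl N B₂ B₃ B₄ P K ⟩
    (N + B₂) * P + ℕ→ℚ 6 * (B₂ + B₃) * K + ℕ→ℚ 6 * (B₃ + B₄) * (P * P)
      ≡⟨ cong₂ (λ a b → a * P + ℕ→ℚ 6 * b * K + ℕ→ℚ 6 * (B₃ + B₄) * (P * P))
               (sym (binom-suc-2 n)) (sym (binom-suc n 2)) ⟩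
    binom (suc n) 2 * P + ℕ→ℚ 6 * binom (suc n) 3 * K + ℕ→ℚ 6 * (B₃ + B₄) * (P * P)
      ≡⟨ cong (λ b → binom (suc n) 2 * P + ℕ→ℚ 6 * binom (suc n) 3 * K + ℕ→ℚ 6 * b * (P * P)) (sym (binom-suc n 3)) ⟩
    binom (suc n) 2 * P + ℕ→ℚ 6 * binom (suc n) 3 * K + ℕ→ℚ 6 * binom (suc n) 4 * (P * P) ∎
    where
    N  = ℕ→ℚ n
    B₂ = binom n 2
    B₃ = binom n 3
    B₄ = binom n 4
    P  = edgeProb
    K  = cherryProb

    D : Config n m → ℚ
    D c = V.E (λ r → degree r c)

    D² : Config n m → ℚ
    D² c = V.E (λ r → degree r c * degree r c)

    E-D² : G.E n D² ≡ N * P + ℕ→ℚ 2 * B₂ * K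
    E-D² = begin
      G.E n (λ c → V.E (λ r → degree r c * degree r c))
        ≡⟨ G-V-swap n (λ c r → degree r c * degree r c) ⟩
      V.E (λ r → G.E n (λ c → degree r c * degree r c))
        ≡⟨ V.E-cong (λ r → E-degree*degree n r r) ⟩
      V.E (λ r → N * coadjProb r r + ℕ→ℚ 2 * B₂ * (adjProb r * adjProb r))
        ≡⟨ V.E-linear N (ℕ→ℚ 2 * B₂) (λ r → coadjProb r r) (λ r → adjProb r * adjProb r) ⟩
      N * V.E (λ r → coadjProb r r) + ℕ→ℚ 2 * B₂ * K
        ≡⟨ cong (λ a → N * a + ℕ→ℚ 2 * B₂ * K) (V.E-cong coadjProb-diag) ⟩
      N * P + ℕ→ℚ 2 * B₂ * K ∎

    E-edges*D : G.E n (λ c → edges c * D c) ≡ ℕ→ℚ 2 * B₂ * K + ℕ→ℚ 3 * B₃ * (P * P)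
    E-edges*D = begin
      G.E n (λ c → edges c * V.E (λ r → degree r c))
        ≡⟨ G.E-cong n (λ c → sym (V.E-*ˡ (edges c) (λ r → degree r c))) ⟩
      G.E n (λ c → V.E (λ r → edges c * degree r c))
        ≡⟨ G-V-swap n (λ c r → edges c * degree r c) ⟩
      V.E (λ r → G.E n (λ c → edges c * degree r c))
        ≡⟨ V.E-cong (E-edges*degree n) ⟩
      V.E (λ r → ℕ→ℚ 2 * B₂ * pathProb r + ℕ→ℚ 3 * B₃ * (P * adjProb r))
        ≡⟨ V.E-linear (ℕ→ℚ 2 * B₂) (ℕ→ℚ 3 * B₃) pathProb (λ r → P * adjProb r) ⟩
      ℕ→ℚ 2 * B₂ * V.E pathProb + ℕ→ℚ 3 * B₃ * V.E (λ r → P * adjProb r)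
        ≡⟨ cong₂ (λ a b → ℕ→ℚ 2 * B₂ * a + ℕ→ℚ 3 * B₃ * b) E-pathProb (V.E-*ˡ P adjProb) ⟩
      ℕ→ℚ 2 * B₂ * K + ℕ→ℚ 3 * B₃ * (P * P) ∎

𝔼ʳ-factor : (p : ℚ) (m : ℕ) (F : Vec Bool (suc m) → ℚ) (h : Bool → ℚ) (G : Vec Bool m → ℚ) →
            (∀ b v → F (b ∷ v) ≡ h b * G v) → 𝔼ʳ p (suc m) F ≡ 𝔼ᵇ p h * 𝔼ʳ p m G
𝔼ʳ-factor p m F h G F≡h*G = begin
  𝔼ʳ p (suc m) F                             ≡⟨ 𝔼ʳ-suc p m F ⟩
  𝔼ʳ p m (λ v → 𝔼ᵇ p (λ b → F (b ∷ v)))      ≡⟨ wsum-cong (rowWeight p) (allBoolVecs m) (λ v →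
                                                   trans (Bernoulli.E-cong p (λ b → F≡h*G b v))
                                                         (Bernoulli.E-*ʳ p (G v) h)) ⟩
  𝔼ʳ p m (λ v → 𝔼ᵇ p h * G v)                ≡⟨ wsum-*ˡ (rowWeight p) (allBoolVecs m) (𝔼ᵇ p h) G ⟩
  𝔼ᵇ p h * 𝔼ʳ p m G                          ∎

coordProduct : {k : ℕ} → (Bool → Bool → Bool → ℚ) → Vec Bool k → Vec Bool k → Vec Bool k → ℚ
coordProduct f []      []      []      = 1ℚ
coordProduct f (b ∷ r) (c ∷ s) (d ∷ t) = f b c d * coordProduct f r s t

𝔼ʳ³-coordProduct : (p : ℚ) (f : Bool → Bool → Bool → ℚ) (m : ℕ) →
  𝔼ʳ p m (λ r → 𝔼ʳ p m (λ s → 𝔼ʳ p m (coordProduct f r s))) ≡ 𝔼ᵇ p (λ b → 𝔼ᵇ p (λ c → 𝔼ᵇ p (f b c))) ^ℚ m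
𝔼ʳ³-coordProduct p f zero    = refl
𝔼ʳ³-coordProduct p f (suc m) = begin
  𝔼ʳ p (suc m) (λ r → 𝔼ʳ p (suc m) (λ s → 𝔼ʳ p (suc m) (coordProduct f r s)))
    ≡⟨ 𝔼ʳ-factor p m _ (λ b → 𝔼ᵇ p (λ c → 𝔼ᵇ p (f b c)))
                       (λ r → 𝔼ʳ p m (λ s → 𝔼ʳ p m (coordProduct f r s))) (λ b r →
         𝔼ʳ-factor p m _ (λ c → 𝔼ᵇ p (f b c)) (λ s → 𝔼ʳ p m (coordProduct f r s)) (λ c s →
           𝔼ʳ-factor p m _ (f b c) (coordProduct f r s) (λ _ _ → refl))) ⟩
  𝔼ᵇ p (λ b → 𝔼ᵇ p (λ c → 𝔼ᵇ p (f b c))) * 𝔼ʳ p m (λ r → 𝔼ʳ p m (λ s → 𝔼ʳ p m (coordProduct f r s)))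
    ≡⟨ cong (𝔼ᵇ p (λ b → 𝔼ᵇ p (λ c → 𝔼ᵇ p (f b c))) *_) (𝔼ʳ³-coordProduct p f m) ⟩
  𝔼ᵇ p (λ b → 𝔼ᵇ p (λ c → 𝔼ᵇ p (f b c))) ^ℚ suc m ∎

disjoint : {m : ℕ} → Vec Bool m → Vec Bool m → ℚ
disjoint r s = if shareAttr r s then 0ℚ else 1ℚ

adj≡1-disjoint : {m : ℕ} (r s : Vec Bool m) → adj r s ≡ 1ℚ - disjoint r s
adj≡1-disjoint r s with shareAttr r s
... | true  = refl
... | false = refl

notBoth : Bool → Bool → ℚ
notBoth b c = if b ∧ c then 0ℚ else 1ℚ

disjoint-∷ : {m : ℕ} (b c : Bool) (r s : Vec Bool m) →
             disjoint (b ∷ r) (c ∷ s) ≡ notBoth b c * disjoint r s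
disjoint-∷ b c r s with b ∧ c
... | true  = sym (ℚ.*-zeroˡ (disjoint r s))
... | false = sym (ℚ.*-identityˡ (disjoint r s))

disjoint≡coordProduct : {m : ℕ} (r s t : Vec Bool m) → disjoint r s ≡ coordProduct (λ b c _ → notBoth b c) r s t
disjoint≡coordProduct []      []      []      = refl
disjoint≡coordProduct (b ∷ r) (c ∷ s) (d ∷ t) =
  trans (disjoint-∷ b c r s) (cong (notBoth b c *_) (disjoint≡coordProduct r s t))

disjoint²≡coordProduct : {m : ℕ} (r s t : Vec Bool m) →
  disjoint r s * disjoint r t ≡ coordProduct (λ b c d → notBoth b c * notBoth b d) r s t
disjoint²≡coordProduct []      []      []      = refl
disjoint²≡coordProduct (b ∷ r) (c ∷ s) (d ∷ t) = begin
  disjoint (b ∷ r) (c ∷ s) * disjoint (b ∷ r) (d ∷ t)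
    ≡⟨ cong₂ _*_ (disjoint-∷ b c r s) (disjoint-∷ b d r t) ⟩
  notBoth b c * disjoint r s * (notBoth b d * disjoint r t)
    ≡⟨ solve 4 (λ x y z w → x :* y :* (z :* w) := x :* z :* (y :* w))
             refl (notBoth b c) (disjoint r s) (notBoth b d) (disjoint r t) ⟩
  notBoth b c * notBoth b d * (disjoint r s * disjoint r t)
    ≡⟨ cong (notBoth b c * notBoth b d *_) (disjoint²≡coordProduct r s t) ⟩
  coordProduct (λ b c d → notBoth b c * notBoth b d) (b ∷ r) (c ∷ s) (d ∷ t) ∎

-- The probabilities that a single attribute is not chosen by both v₁ and v₂, resp. by neither
-- of the pairs v₁v₂ and v₁v₃.
pairMiss : ℚ → ℚ
pairMiss p = 1ℚ - p * p

cherryMiss : ℚ → ℚ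
cherryMiss p = 1ℚ - ℕ→ℚ 2 * p ^ℚ 2 + p ^ℚ 3

𝔼ᵇ-notBoth : (p : ℚ) (b : Bool) → 𝔼ᵇ p (notBoth b) ≡ (if b then 1ℚ - p else 1ℚ)
𝔼ᵇ-notBoth p true  = solve 1 (λ p → p :* con 0ℚ :+ ((con 1ℚ :- p) :* con 1ℚ :+ con 0ℚ) := con 1ℚ :- p) refl p
𝔼ᵇ-notBoth p false = 𝔼ᵇ-total p

𝔼ᵇ³-notBoth : (p : ℚ) → 𝔼ᵇ p (λ b → 𝔼ᵇ p (λ c → 𝔼ᵇ p (λ _ → notBoth b c))) ≡ pairMiss p
𝔼ᵇ³-notBoth p = begin
  𝔼ᵇ p (λ b → 𝔼ᵇ p (λ c → 𝔼ᵇ p (λ _ → notBoth b c)))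
    ≡⟨ Bernoulli.E-cong p (λ b → trans (Bernoulli.E-cong p (λ c → Bernoulli.E-const p (notBoth b c)))
                                       (𝔼ᵇ-notBoth p b)) ⟩
  𝔼ᵇ p (λ b → if b then 1ℚ - p else 1ℚ)
    ≡⟨ solve 1 (λ p → p :* (con 1ℚ :- p) :+ ((con 1ℚ :- p) :* con 1ℚ :+ con 0ℚ) := con 1ℚ :- p :* p) refl p ⟩
  pairMiss p ∎

𝔼ᵇ³-notBoth² : (p : ℚ) → 𝔼ᵇ p (λ b → 𝔼ᵇ p (λ c → 𝔼ᵇ p (λ d → notBoth b c * notBoth b d))) ≡ cherryMiss p
𝔼ᵇ³-notBoth² p = begin
  𝔼ᵇ p (λ b → 𝔼ᵇ p (λ c → 𝔼ᵇ p (λ d → notBoth b c * notBoth b d)))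
    ≡⟨ Bernoulli.E-cong p (λ b → trans (Bernoulli.E-cong p (λ c → Bernoulli.E-*ˡ p (notBoth b c) (notBoth b)))
                                       (Bernoulli.E-*ʳ p (𝔼ᵇ p (notBoth b)) (notBoth b))) ⟩
  𝔼ᵇ p (λ b → 𝔼ᵇ p (notBoth b) * 𝔼ᵇ p (notBoth b))
    ≡⟨ Bernoulli.E-cong p (λ b → cong (λ e → e * e) (𝔼ᵇ-notBoth p b)) ⟩
  𝔼ᵇ p (λ b → (if b then 1ℚ - p else 1ℚ) * (if b then 1ℚ - p else 1ℚ))
    ≡⟨ solve 1 (λ p → p :* ((con 1ℚ :- p) :* (con 1ℚ :- p)) :+ ((con 1ℚ :- p) :* (con 1ℚ :* con 1ℚ) :+ con 0ℚ)
                      := con 1ℚ :- con (ℕ→ℚ 2) :* (p :* (p :* con 1ℚ)) :+ p :* (p :* (p :* con 1ℚ))) refl p ⟩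
  cherryMiss p ∎

module Probabilities (p : ℚ) (m : ℕ) where
  open Moments p m

  isolationProb : Row → ℚ
  isolationProb r = V.E (disjoint r)

  adjProb≡ : (r : Row) → adjProb r ≡ 1ℚ - isolationProb r
  adjProb≡ r = trans (V.E-cong (adj≡1-disjoint r)) (V.E-const-minus 1ℚ (disjoint r))

  E-isolationProb : V.E isolationProb ≡ pairMiss p ^ℚ m
  E-isolationProb = begin
    V.E (λ r → V.E (λ s → disjoint r s))
      ≡⟨ V.E-cong (λ r → V.E-cong (λ s → sym (V.E-const (disjoint r s)))) ⟩
    V.E (λ r → V.E (λ s → V.E (λ _ → disjoint r s)))
      ≡⟨ V.E-cong (λ r → V.E-cong (λ s → V.E-cong (disjoint≡coordProduct r s))) ⟩
    V.E (λ r → V.E (λ s → V.E (coordProduct (λ b c _ → notBoth b c) r s)))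
      ≡⟨ 𝔼ʳ³-coordProduct p (λ b c _ → notBoth b c) m ⟩
    𝔼ᵇ p (λ b → 𝔼ᵇ p (λ c → 𝔼ᵇ p (λ _ → notBoth b c))) ^ℚ m
      ≡⟨ cong (_^ℚ m) (𝔼ᵇ³-notBoth p) ⟩
    pairMiss p ^ℚ m ∎

  E-isolationProb² : V.E (λ r → isolationProb r * isolationProb r) ≡ cherryMiss p ^ℚ m
  E-isolationProb² = begin
    V.E (λ r → V.E (disjoint r) * V.E (disjoint r))
      ≡⟨ V.E-cong (λ r → trans (sym (V.E-*ʳ (V.E (disjoint r)) (disjoint r)))
                              (V.E-cong (λ s → sym (V.E-*ˡ (disjoint r s) (disjoint r))))) ⟩
    V.E (λ r → V.E (λ s → V.E (λ t → disjoint r s * disjoint r t)))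
      ≡⟨ V.E-cong (λ r → V.E-cong (λ s → V.E-cong (disjoint²≡coordProduct r s))) ⟩
    V.E (λ r → V.E (λ s → V.E (coordProduct (λ b c d → notBoth b c * notBoth b d) r s)))
      ≡⟨ 𝔼ʳ³-coordProduct p (λ b c d → notBoth b c * notBoth b d) m ⟩
    𝔼ᵇ p (λ b → 𝔼ᵇ p (λ c → 𝔼ᵇ p (λ d → notBoth b c * notBoth b d))) ^ℚ m
      ≡⟨ cong (_^ℚ m) (𝔼ᵇ³-notBoth² p) ⟩
    cherryMiss p ^ℚ m ∎

  edgeProb≡ : edgeProb ≡ 1ℚ - pairMiss p ^ℚ m
  edgeProb≡ = begin
    V.E adjProb                         ≡⟨ V.E-cong adjProb≡ ⟩
    V.E (λ r → 1ℚ - isolationProb r)    ≡⟨ V.E-const-minus 1ℚ isolationProb ⟩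
    1ℚ - V.E isolationProb              ≡⟨ cong (λ a → 1ℚ - a) E-isolationProb ⟩
    1ℚ - pairMiss p ^ℚ m                ∎

  cherryProb≡ : cherryProb ≡ 1ℚ - ℕ→ℚ 2 * pairMiss p ^ℚ m + cherryMiss p ^ℚ m
  cherryProb≡ = begin
    V.E (λ r → adjProb r * adjProb r)
      ≡⟨ V.E-cong (λ r → trans (cong (λ a → a * a) (adjProb≡ r))
                              (solve 1 (λ ι → (con 1ℚ :- ι) :* (con 1ℚ :- ι) := con 1ℚ :+ (con (- ℕ→ℚ 2) :* ι :+ ι :* ι))
                                     refl (isolationProb r))) ⟩
    V.E (λ r → 1ℚ + (- ℕ→ℚ 2 * isolationProb r + isolationProb r * isolationProb r))
      ≡⟨ trans (V.E-const-+ 1ℚ _) (cong (1ℚ +_) (V.E-+ _ _)) ⟩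
    1ℚ + (V.E (λ r → - ℕ→ℚ 2 * isolationProb r) + V.E (λ r → isolationProb r * isolationProb r))
      ≡⟨ cong₂ (λ a b → 1ℚ + (a + b)) (trans (V.E-*ˡ (- ℕ→ℚ 2) isolationProb) (cong (- ℕ→ℚ 2 *_) E-isolationProb))
                                       E-isolationProb² ⟩
    1ℚ + (- ℕ→ℚ 2 * pairMiss p ^ℚ m + cherryMiss p ^ℚ m)
      ≡⟨ solve 2 (λ A Q → con 1ℚ :+ (con (- ℕ→ℚ 2) :* A :+ Q) := con 1ℚ :- con (ℕ→ℚ 2) :* A :+ Q)
               refl (pairMiss p ^ℚ m) (cherryMiss p ^ℚ m) ⟩
    1ℚ - ℕ→ℚ 2 * pairMiss p ^ℚ m + cherryMiss p ^ℚ m ∎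

VarNE≡ : (n m : ℕ) (p : ℚ) →
  VarNE n m p ≡ binom n 2 * phat m p * (1ℚ - phat m p) + ℕ→ℚ 6 * binom n 3 * (cherryMiss p ^ℚ m - (1ℚ - phat m p) ^ℚ 2)
VarNE≡ n m p = begin
  VarNE n m p
    ≡⟨ cong₂ (λ a b → a - b * b) (G.E-cong n (λ c → cong₂ _*_ (ℕ→ℚ-numEdges c) (ℕ→ℚ-numEdges c)))
                                 (G.E-cong n ℕ→ℚ-numEdges) ⟩
  G.E n (λ c → edges c * edges c) - G.E n edges * G.E n edges
    ≡⟨ cong₂ (λ a b → a - b * b) (E-edges² n) (E-edges n) ⟩
  B₂ * P + ℕ→ℚ 6 * B₃ * K + ℕ→ℚ 6 * B₄ * (P * P) - B₂ * P * (B₂ * P)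
    ≡⟨ cong (λ b → B₂ * P + ℕ→ℚ 6 * B₃ * K + ℕ→ℚ 6 * B₄ * (P * P) - b)
            (solve 2 (λ B P → B :* P :* (B :* P) := B :* B :* (P :* P)) refl B₂ P) ⟩
  B₂ * P + ℕ→ℚ 6 * B₃ * K + ℕ→ℚ 6 * B₄ * (P * P) - B₂ * B₂ * (P * P)
    ≡⟨ cong (λ b → B₂ * P + ℕ→ℚ 6 * B₃ * K + ℕ→ℚ 6 * B₄ * (P * P) - b * (P * P)) (binom-2² n) ⟩
  B₂ * P + ℕ→ℚ 6 * B₃ * K + ℕ→ℚ 6 * B₄ * (P * P) - (B₂ + ℕ→ℚ 6 * B₃ + ℕ→ℚ 6 * B₄) * (P * P)
    ≡⟨ cong₂ (λ P K → B₂ * P + ℕ→ℚ 6 * B₃ * K + ℕ→ℚ 6 * B₄ * (P * P) - (B₂ + ℕ→ℚ 6 * B₃ + ℕ→ℚ 6 * B₄) * (P * P))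
             edgeProb≡ cherryProb≡ ⟩
  B₂ * (1ℚ - A) + ℕ→ℚ 6 * B₃ * (1ℚ - ℕ→ℚ 2 * A + Q) + ℕ→ℚ 6 * B₄ * ((1ℚ - A) * (1ℚ - A))
    - (B₂ + ℕ→ℚ 6 * B₃ + ℕ→ℚ 6 * B₄) * ((1ℚ - A) * (1ℚ - A))
    ≡⟨ solve 5 (λ B₂ B₃ B₄ A Q →
           B₂ :* (con 1ℚ :- A) :+ con (ℕ→ℚ 6) :* B₃ :* (con 1ℚ :- con (ℕ→ℚ 2) :* A :+ Q)
             :+ con (ℕ→ℚ 6) :* B₄ :* ((con 1ℚ :- A) :* (con 1ℚ :- A))
             :- (B₂ :+ con (ℕ→ℚ 6) :* B₃ :+ con (ℕ→ℚ 6) :* B₄) :* ((con 1ℚ :- A) :* (con 1ℚ :- A))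
         := B₂ :* (con 1ℚ :- A) :* (con 1ℚ :- (con 1ℚ :- A))
             :+ con (ℕ→ℚ 6) :* B₃ :* (Q :- (con 1ℚ :- (con 1ℚ :- A)) :* ((con 1ℚ :- (con 1ℚ :- A)) :* con 1ℚ)))
         refl B₂ B₃ B₄ A Q ⟩
  B₂ * phat m p * (1ℚ - phat m p) + ℕ→ℚ 6 * B₃ * (Q - (1ℚ - phat m p) ^ℚ 2) ∎
  where
  open Moments p m
  open Probabilities p m
  B₂ = binom n 2
  B₃ = binom n 3
  B₄ = binom n 4
  P  = edgeProb
  K  = cherryProb
  A  = pairMiss p ^ℚ m
  Q  = cherryMiss p ^ℚ m

0≤1 : 0ℚ ≤ 1ℚ
0≤1 = ℚ.nonNegative⁻¹ 1ℚ

0≤-+ : {a b : ℚ} → 0ℚ ≤ a → 0ℚ ≤ b → 0ℚ ≤ a + b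
0≤-+ = ℚ.+-mono-≤

0≤-* : {a b : ℚ} → 0ℚ ≤ a → 0ℚ ≤ b → 0ℚ ≤ a * b
0≤-* {a} {b} 0≤a 0≤b = ℚ.nonNegative⁻¹ (a * b) {{ℚ.nonNeg*nonNeg⇒nonNeg a {{nonNegative 0≤a}} b {{nonNegative 0≤b}}}}

a≤b⇒0≤b-a : {a b : ℚ} → a ≤ b → 0ℚ ≤ b - a
a≤b⇒0≤b-a {a} {b} a≤b = subst (_≤ b - a) (ℚ.+-inverseʳ a) (ℚ.+-monoˡ-≤ (- a) a≤b)

≤-by : (a b d : ℚ) → 0ℚ ≤ d → b - a ≡ d → a ≤ b
≤-by a b d 0≤d b-a≡d = subst₂ _≤_ (ℚ.+-identityʳ a) b≡a+d (ℚ.+-monoʳ-≤ a 0≤d)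
  where
  b≡a+d : a + d ≡ b
  b≡a+d = trans (cong (a +_) (sym b-a≡d)) (solve 2 (λ a b → a :+ (b :- a) := b) refl a b)

0≤a*a : (a : ℚ) → 0ℚ ≤ a * a
0≤a*a a = [ (λ 0≤a → 0≤-* 0≤a 0≤a)
           , (λ a≤0 → subst (0ℚ ≤_) (neg*neg a) (0≤-* (0≤-a a≤0) (0≤-a a≤0)))
           ]′ (ℚ.≤-total 0ℚ a)
  where
  neg*neg : (a : ℚ) → - a * - a ≡ a * a
  neg*neg a = solve 1 (λ a → (:- a) :* (:- a) := a :* a) refl a
  0≤-a : {a : ℚ} → a ≤ 0ℚ → 0ℚ ≤ - a
  0≤-a {a} a≤0 = subst (0ℚ ≤_) (ℚ.+-identityˡ (- a)) (a≤b⇒0≤b-a a≤0)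

0≤ℕ→ℚ : (n : ℕ) → 0ℚ ≤ ℕ→ℚ n
0≤ℕ→ℚ n = subst (0ℚ ≤_) (sym (ℕ→ℚ≡mkℚ n)) (ℚ.nonNegative⁻¹ _)

a≤b⇒a*c≤b*c : {a b c : ℚ} → 0ℚ ≤ c → a ≤ b → a * c ≤ b * c
a≤b⇒a*c≤b*c {c = c} 0≤c = ℚ.*-monoʳ-≤-nonNeg c {{nonNegative 0≤c}}

*-mono-≤-nonNeg : {a b c d : ℚ} → 0ℚ ≤ a → 0ℚ ≤ c → a ≤ b → c ≤ d → a * c ≤ b * d
*-mono-≤-nonNeg {b = b} 0≤a 0≤c a≤b c≤d =
  ℚ.≤-trans (a≤b⇒a*c≤b*c 0≤c a≤b) (ℚ.*-monoˡ-≤-nonNeg b {{nonNegative (ℚ.≤-trans 0≤a a≤b)}} c≤d)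

0≤a^n : (a : ℚ) (n : ℕ) → 0ℚ ≤ a → 0ℚ ≤ a ^ℚ n
0≤a^n a zero    0≤a = 0≤1
0≤a^n a (suc n) 0≤a = 0≤-* 0≤a (0≤a^n a n 0≤a)

^-mono-≤ : {a b : ℚ} (n : ℕ) → 0ℚ ≤ a → a ≤ b → a ^ℚ n ≤ b ^ℚ n
^-mono-≤ zero    0≤a a≤b = ℚ.≤-refl
^-mono-≤ {a} (suc n) 0≤a a≤b = *-mono-≤-nonNeg 0≤a (0≤a^n a n 0≤a) a≤b (^-mono-≤ n 0≤a a≤b)

[a*b]^n≡a^n*b^n : (a b : ℚ) (n : ℕ) → (a * b) ^ℚ n ≡ a ^ℚ n * b ^ℚ n
[a*b]^n≡a^n*b^n a b zero    = refl
[a*b]^n≡a^n*b^n a b (suc n) = trans (cong (a * b *_) ([a*b]^n≡a^n*b^n a b n))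
  (solve 4 (λ a b x y → a :* b :* (x :* y) := a :* x :* (b :* y)) refl a b (a ^ℚ n) (b ^ℚ n))

a^n≤1 : {a : ℚ} (n : ℕ) → 0ℚ ≤ a → a ≤ 1ℚ → a ^ℚ n ≤ 1ℚ
a^n≤1 zero    0≤a a≤1 = ℚ.≤-refl
a^n≤1 {a} (suc n) 0≤a a≤1 =
  subst (a ^ℚ suc n ≤_) (ℚ.*-identityˡ 1ℚ) (*-mono-≤-nonNeg 0≤a (0≤a^n _ n 0≤a) a≤1 (a^n≤1 n 0≤a a≤1))

q^m-s^m≤m*d*q^m : {s q d : ℚ} → 0ℚ ≤ s → s ≤ q → 0ℚ ≤ d → q - s ≤ d * q →
                  (m : ℕ) → q ^ℚ m - s ^ℚ m ≤ ℕ→ℚ m * d * q ^ℚ m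
q^m-s^m≤m*d*q^m {s} {q} {d} 0≤s s≤q 0≤d q-s≤d*q zero =
  ≤-by _ _ 0ℚ ℚ.≤-refl (solve 1 (λ d → con 0ℚ :* d :* con 1ℚ :- (con 1ℚ :- con 1ℚ) := con 0ℚ) refl d)
q^m-s^m≤m*d*q^m {s} {q} {d} 0≤s s≤q 0≤d q-s≤d*q (suc m) = ≤-by _ _
  (q * (M * d * Q - (Q - S)) + Q * (d * q - (q - s)) + (Q - S) * (q - s))
  (0≤-+ (0≤-+ (0≤-* 0≤q (a≤b⇒0≤b-a (q^m-s^m≤m*d*q^m 0≤s s≤q 0≤d q-s≤d*q m)))
              (0≤-* (0≤a^n q m 0≤q) (a≤b⇒0≤b-a q-s≤d*q)))
        (0≤-* (a≤b⇒0≤b-a (^-mono-≤ m 0≤s s≤q)) (a≤b⇒0≤b-a s≤q)))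
  (trans (cong (λ k → k * d * (q * Q) - (q * Q - s * S)) (ℕ→ℚ-suc m))
    (solve 6 (λ M d q s Q S → (con 1ℚ :+ M) :* d :* (q :* Q) :- (q :* Q :- s :* S)
                             := q :* (M :* d :* Q :- (Q :- S)) :+ Q :* (d :* q :- (q :- s)) :+ (Q :- S) :* (q :- s))
      refl M d q s Q S))
  where
  M = ℕ→ℚ m
  Q = q ^ℚ m
  S = s ^ℚ m
  0≤q = ℚ.≤-trans 0≤s s≤q

s^m*[q+m*[q-s]]≤q*q^m : {s q : ℚ} → 0ℚ ≤ s → s ≤ q → (m : ℕ) → s ^ℚ m * (q + ℕ→ℚ m * (q - s)) ≤ q * q ^ℚ m
s^m*[q+m*[q-s]]≤q*q^m {s} {q} 0≤s s≤q zero =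
  ≤-by _ _ 0ℚ ℚ.≤-refl (solve 2 (λ s q → q :* con 1ℚ :- con 1ℚ :* (q :+ con 0ℚ :* (q :- s)) := con 0ℚ) refl s q)
s^m*[q+m*[q-s]]≤q*q^m {s} {q} 0≤s s≤q (suc m) = ≤-by _ _
  (s * (q * Q - S * (q + M * (q - s))) + (q - s) * (q * Q - s * S))
  (0≤-+ (0≤-* 0≤s (a≤b⇒0≤b-a (s^m*[q+m*[q-s]]≤q*q^m 0≤s s≤q m)))
        (0≤-* (a≤b⇒0≤b-a s≤q) (a≤b⇒0≤b-a (^-mono-≤ (suc m) 0≤s s≤q))))
  (trans (cong (λ k → q * (q * Q) - s * S * (q + k * (q - s))) (ℕ→ℚ-suc m))
    (solve 5 (λ M q s Q S → q :* (q :* Q) :- s :* S :* (q :+ (con 1ℚ :+ M) :* (q :- s))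
                           := s :* (q :* Q :- S :* (q :+ M :* (q :- s))) :+ (q :- s) :* (q :* Q :- s :* S))
      refl M q s Q S))
  where
  M = ℕ→ℚ m
  Q = q ^ℚ m
  S = s ^ℚ m

m*[q-s]*s^m≤q^m-s^m : {s q : ℚ} → 0ℚ ≤ s → s ≤ q → s ≤ 1ℚ →
                      (m : ℕ) → ℕ→ℚ m * (q - s) * s ^ℚ m ≤ q ^ℚ m - s ^ℚ m
m*[q-s]*s^m≤q^m-s^m {s} {q} 0≤s s≤q s≤1 zero =
  ≤-by _ _ 0ℚ ℚ.≤-refl (solve 2 (λ s q → (con 1ℚ :- con 1ℚ) :- con 0ℚ :* (q :- s) :* con 1ℚ := con 0ℚ) refl s q)
m*[q-s]*s^m≤q^m-s^m {s} {q} 0≤s s≤q s≤1 (suc m) = ≤-by _ _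
  ((q - s) * (Q - S) + s * ((Q - S) - M * (q - s) * S) + S * (q - s) * (1ℚ - s))
  (0≤-+ (0≤-+ (0≤-* (a≤b⇒0≤b-a s≤q) (a≤b⇒0≤b-a (^-mono-≤ m 0≤s s≤q)))
              (0≤-* 0≤s (a≤b⇒0≤b-a (m*[q-s]*s^m≤q^m-s^m 0≤s s≤q s≤1 m))))
        (0≤-* (0≤-* (0≤a^n s m 0≤s) (a≤b⇒0≤b-a s≤q)) (a≤b⇒0≤b-a s≤1)))
  (trans (cong (λ k → (q * Q - s * S) - k * (q - s) * (s * S)) (ℕ→ℚ-suc m))
    (solve 5 (λ M q s Q S → (q :* Q :- s :* S) :- (con 1ℚ :+ M) :* (q :- s) :* (s :* S)
                           := (q :- s) :* (Q :- S) :+ s :* ((Q :- S) :- M :* (q :- s) :* S) :+ S :* (q :- s) :* (con 1ℚ :- s))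
      refl M q s Q S))
  where
  M = ℕ→ℚ m
  Q = q ^ℚ m
  S = s ^ℚ m

[1+2y]^m*[1-my]²≤1 : {y : ℚ} → 0ℚ ≤ y → (m : ℕ) → ℕ→ℚ m * y ≤ 1ℚ →
                     (1ℚ + (y + y)) ^ℚ m * ((1ℚ - ℕ→ℚ m * y) * (1ℚ - ℕ→ℚ m * y)) ≤ 1ℚ
[1+2y]^m*[1-my]²≤1 {y} 0≤y zero    my≤1 =
  ≤-by _ _ 0ℚ ℚ.≤-refl
    (solve 1 (λ y → con 1ℚ :- con 1ℚ :* ((con 1ℚ :- con 0ℚ :* y) :* (con 1ℚ :- con 0ℚ :* y)) := con 0ℚ) refl y)
[1+2y]^m*[1-my]²≤1 {y} 0≤y (suc m) [1+m]y≤1 = ≤-by _ _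
  ((1ℚ - Y * ((1ℚ - M * y) * (1ℚ - M * y))) + Y * ((y + y) * (1ℚ - (1ℚ + M) * y) * ((1ℚ + M) * y) + y * y))
  (0≤-+ (a≤b⇒0≤b-a (([1+2y]^m*[1-my]²≤1 0≤y m my≤1)))
        (0≤-* (0≤a^n _ m (0≤-+ 0≤1 0≤2y))
              (0≤-+ (0≤-* (0≤-* 0≤2y (a≤b⇒0≤b-a [1+m]y≤1′)) (0≤-* (0≤-+ 0≤1 (0≤ℕ→ℚ m)) 0≤y))
                    (0≤a*a y))))
  (trans (cong (λ k → 1ℚ - (1ℚ + (y + y)) * Y * ((1ℚ - k * y) * (1ℚ - k * y))) (ℕ→ℚ-suc m))
    (solve 3 (λ M y Y → con 1ℚ :- (con 1ℚ :+ (y :+ y)) :* Y :* ((con 1ℚ :- (con 1ℚ :+ M) :* y) :* (con 1ℚ :- (con 1ℚ :+ M) :* y))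
                       := (con 1ℚ :- Y :* ((con 1ℚ :- M :* y) :* (con 1ℚ :- M :* y)))
                          :+ Y :* ((y :+ y) :* (con 1ℚ :- (con 1ℚ :+ M) :* y) :* ((con 1ℚ :+ M) :* y) :+ y :* y))
      refl M y Y))
  where
  M = ℕ→ℚ m
  Y = (1ℚ + (y + y)) ^ℚ m
  0≤2y = 0≤-+ 0≤y 0≤y
  [1+m]y≤1′ : (1ℚ + M) * y ≤ 1ℚ
  [1+m]y≤1′ = subst (λ k → k * y ≤ 1ℚ) (ℕ→ℚ-suc m) [1+m]y≤1
  my≤1 : M * y ≤ 1ℚ
  my≤1 = ℚ.≤-trans (≤-by _ _ y 0≤y (solve 2 (λ M y → (con 1ℚ :+ M) :* y :- M :* y := y) refl M y)) [1+m]y≤1′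

module AttributeBounds (p : ℚ) (0≤p : 0ℚ ≤ p) (p<1 : p < 1ℚ) where

  p³ : ℚ
  p³ = p ^ℚ 3

  s : ℚ
  s = pairMiss p * pairMiss p

  q : ℚ
  q = cherryMiss p

  0≤p³ : 0ℚ ≤ p³
  0≤p³ = 0≤a^n p 3 0≤p

  0<1-p : 0ℚ < 1ℚ - p
  0<1-p = subst (_< 1ℚ - p) (ℚ.+-inverseʳ p) (ℚ.+-monoˡ-< (- p) p<1)

  0≤1-p : 0ℚ ≤ 1ℚ - p
  0≤1-p = ℚ.<⇒≤ 0<1-p

  0≤pairMiss : 0ℚ ≤ pairMiss p
  0≤pairMiss = ≤-by _ _ ((1ℚ - p) * (1ℚ + p)) (0≤-* 0≤1-p (0≤-+ 0≤1 0≤p))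
    (solve 1 (λ p → con 1ℚ :- p :* p :- con 0ℚ := (con 1ℚ :- p) :* (con 1ℚ :+ p)) refl p)

  pairMiss≤1 : pairMiss p ≤ 1ℚ
  pairMiss≤1 = ≤-by _ _ (p * p) (0≤a*a p) (solve 1 (λ p → con 1ℚ :- (con 1ℚ :- p :* p) := p :* p) refl p)

  0≤s : 0ℚ ≤ s
  0≤s = 0≤a*a (pairMiss p)

  s≤1 : s ≤ 1ℚ
  s≤1 = subst (s ≤_) (ℚ.*-identityˡ 1ℚ) (*-mono-≤-nonNeg 0≤pairMiss 0≤pairMiss pairMiss≤1 pairMiss≤1)

  q-s≡p³*[1-p] : q - s ≡ p³ * (1ℚ - p)
  q-s≡p³*[1-p] = solve 1 (λ p → let p³ = p :* (p :* (p :* con 1ℚ)) in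
      con 1ℚ :- con (ℕ→ℚ 2) :* (p :* (p :* con 1ℚ)) :+ p³ :- (con 1ℚ :- p :* p) :* (con 1ℚ :- p :* p)
    := p³ :* (con 1ℚ :- p)) refl p

  s≤q : s ≤ q
  s≤q = ≤-by s q _ (0≤-* 0≤p³ 0≤1-p) q-s≡p³*[1-p]

  1-p≤q : 1ℚ - p ≤ q
  1-p≤q = ≤-by _ _ (p * ((1ℚ - p) * (1ℚ - p))) (0≤-* 0≤p (0≤a*a (1ℚ - p)))
    (solve 1 (λ p → con 1ℚ :- con (ℕ→ℚ 2) :* (p :* (p :* con 1ℚ)) :+ p :* (p :* (p :* con 1ℚ)) :- (con 1ℚ :- p)
                   := p :* ((con 1ℚ :- p) :* (con 1ℚ :- p))) refl p)

  0<q : 0ℚ < q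
  0<q = ℚ.<-≤-trans 0<1-p 1-p≤q

  0≤q : 0ℚ ≤ q
  0≤q = ℚ.<⇒≤ 0<q

  q-s≤p³*q : q - s ≤ p³ * q
  q-s≤p³*q = subst (_≤ p³ * q) (sym q-s≡p³*[1-p]) (*-mono-≤-nonNeg 0≤p³ 0≤1-p ℚ.≤-refl 1-p≤q)

  q^m-s^m≤q^m*mp³ : (m : ℕ) → q ^ℚ m - s ^ℚ m ≤ q ^ℚ m * (ℕ→ℚ m * p³)
  q^m-s^m≤q^m*mp³ m = subst (q ^ℚ m - s ^ℚ m ≤_) (solve 3 (λ M p³ Q → M :* p³ :* Q := Q :* (M :* p³)) refl (ℕ→ℚ m) p³ (q ^ℚ m))
    (q^m-s^m≤m*d*q^m 0≤s s≤q 0≤p³ q-s≤p³*q m)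

  q^m-s^m≤q^m*[1⊓mp³] : (m : ℕ) → q ^ℚ m - s ^ℚ m ≤ q ^ℚ m * (1ℚ ⊓ (ℕ→ℚ m * p³))
  q^m-s^m≤q^m*[1⊓mp³] m = [ (λ μ≡1 → subst (λ μ → q ^ℚ m - s ^ℚ m ≤ q ^ℚ m * μ) (sym μ≡1) q^m-s^m≤q^m*1)
                          , (λ μ≡u → subst (λ μ → q ^ℚ m - s ^ℚ m ≤ q ^ℚ m * μ) (sym μ≡u) (q^m-s^m≤q^m*mp³ m))
                          ]′ (ℚ.⊓-sel 1ℚ (ℕ→ℚ m * p³))
    where
    q^m-s^m≤q^m*1 : q ^ℚ m - s ^ℚ m ≤ q ^ℚ m * 1ℚ
    q^m-s^m≤q^m*1 = ≤-by _ _ (s ^ℚ m) (0≤a^n s m 0≤s)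
      (solve 2 (λ Q S → Q :* con 1ℚ :- (Q :- S) := S) refl (q ^ℚ m) (s ^ℚ m))

  -- Bernoulli's inequality gives q^m - s^m ≥ q^m y / (q + y) for y = m (q - s) = m p³ (1 - p),
  -- and (2/5) (1 ⊓ m p³) (q + y) ≤ y because 2 q ≤ 3 (1 - p).
  2/5*q^m*[1⊓mp³]≤q^m-s^m : (m : ℕ) → ℤ.+ 2 / 5 * (q ^ℚ m * (1ℚ ⊓ (ℕ→ℚ m * p³))) ≤ q ^ℚ m - s ^ℚ m
  2/5*q^m*[1⊓mp³]≤q^m-s^m m = ℚ.*-cancelʳ-≤-pos (q + y) {{positive 0<q+y}} (ℚ.≤-trans lower upper)
    where
    M = ℕ→ℚ m
    u = M * p³
    μ = 1ℚ ⊓ u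
    y = M * (q - s)
    0≤y : 0ℚ ≤ y
    0≤y = 0≤-* (0≤ℕ→ℚ m) (a≤b⇒0≤b-a s≤q)
    0<q+y : 0ℚ < q + y
    0<q+y = ℚ.+-mono-<-≤ 0<q 0≤y
    upper : q ^ℚ m * y ≤ (q ^ℚ m - s ^ℚ m) * (q + y)
    upper = ≤-by _ _ (q * q ^ℚ m - s ^ℚ m * (q + y)) (a≤b⇒0≤b-a (s^m*[q+m*[q-s]]≤q*q^m 0≤s s≤q m))
      (solve 4 (λ Q S q y → (Q :- S) :* (q :+ y) :- Q :* y := q :* Q :- S :* (q :+ y)) refl (q ^ℚ m) (s ^ℚ m) q y)
    lower : ℤ.+ 2 / 5 * (q ^ℚ m * μ) * (q + y) ≤ q ^ℚ m * y
    lower = ≤-by _ _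
      (q ^ℚ m * (ℤ.+ 2 / 5 * (1ℚ - μ) * y + ℤ.+ 2 / 5 * (u - μ) * q + ℤ.+ 2 / 5 * u * (1ℚ - p) * ((p - ½) * (p - ½) + ½ * ½)))
      (0≤-* (0≤a^n q m 0≤q)
        (0≤-+ (0≤-+ (0≤-* (0≤-* (ℚ.nonNegative⁻¹ (ℤ.+ 2 / 5)) (a≤b⇒0≤b-a (ℚ.p⊓q≤p 1ℚ u))) 0≤y)
                    (0≤-* (0≤-* (ℚ.nonNegative⁻¹ (ℤ.+ 2 / 5)) (a≤b⇒0≤b-a (ℚ.p⊓q≤q 1ℚ u))) 0≤q))
              (0≤-* (0≤-* (0≤-* (ℚ.nonNegative⁻¹ (ℤ.+ 2 / 5)) (0≤-* (0≤ℕ→ℚ m) 0≤p³)) 0≤1-p)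
                    (0≤-+ (0≤a*a (p - ½)) (0≤a*a ½)))))
      (solve 4 (λ Q μ M p →
          let p³ = p :* (p :* (p :* con 1ℚ))
              q  = con 1ℚ :- con (ℕ→ℚ 2) :* (p :* (p :* con 1ℚ)) :+ p³
              s  = (con 1ℚ :- p :* p) :* (con 1ℚ :- p :* p)
              y  = M :* (q :- s)
              u  = M :* p³
              c  = con (ℤ.+ 2 / 5)
          in Q :* y :- c :* (Q :* μ) :* (q :+ y)
             := Q :* (c :* (con 1ℚ :- μ) :* y :+ c :* (u :- μ) :* q
                      :+ c :* u :* (con 1ℚ :- p) :* ((p :- con ½) :* (p :- con ½) :+ con ½ :* con ½)))
        refl (q ^ℚ m) μ M p)

  module Sparse (m : ℕ) (3≤m : 3 ℕ.≤ m) (mp³≤1 : ℕ→ℚ m * p³ ≤ 1ℚ) where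

    M : ℚ
    M = ℕ→ℚ m

    3≤M : ℕ→ℚ 3 ≤ M
    3≤M = ≤-by _ _ (ℕ→ℚ (m ℕ.∸ 3)) (0≤ℕ→ℚ (m ℕ.∸ 3))
      (trans (cong (_- ℕ→ℚ 3) (ℕ→ℚ-split 3≤m)) (solve 2 (λ a b → a :+ b :- a := b) refl (ℕ→ℚ 3) (ℕ→ℚ (m ℕ.∸ 3))))

    -- 3 · (7/10)³ > 1
    p≤7/10 : p ≤ ℤ.+ 7 / 10
    p≤7/10 = [ (λ p≤7/10 → p≤7/10) , (λ 7/10≤p → ⊥-elim (ℚ.≤⇒≤ᵇ (3*[7/10]³≤1 7/10≤p))) ]′
               (ℚ.≤-total p (ℤ.+ 7 / 10))
      where
      3*[7/10]³≤1 : ℤ.+ 7 / 10 ≤ p → ℕ→ℚ 3 * (ℤ.+ 7 / 10) ^ℚ 3 ≤ 1ℚ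
      3*[7/10]³≤1 7/10≤p = ℚ.≤-trans
        (*-mono-≤-nonNeg (0≤ℕ→ℚ 3) (ℚ.nonNegative⁻¹ ((ℤ.+ 7 / 10) ^ℚ 3)) 3≤M
                         (^-mono-≤ 3 (ℚ.nonNegative⁻¹ (ℤ.+ 7 / 10)) 7/10≤p))
        mp³≤1

    3/10*mp³*s^m≤q^m-s^m : ℤ.+ 3 / 10 * (M * p³ * s ^ℚ m) ≤ q ^ℚ m - s ^ℚ m
    3/10*mp³*s^m≤q^m-s^m = ℚ.≤-trans
      (≤-by _ _ (M * p³ * s ^ℚ m * (ℤ.+ 7 / 10 - p))
        (0≤-* (0≤-* (0≤-* (0≤ℕ→ℚ m) 0≤p³) (0≤a^n s m 0≤s)) (a≤b⇒0≤b-a p≤7/10))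
        (trans (cong (λ d → M * d * s ^ℚ m - ℤ.+ 3 / 10 * (M * p³ * s ^ℚ m)) q-s≡p³*[1-p])
          (solve 4 (λ M p³ S p → M :* (p³ :* (con 1ℚ :- p)) :* S :- con (ℤ.+ 3 / 10) :* (M :* p³ :* S)
                              := M :* p³ :* S :* (con (ℤ.+ 7 / 10) :- p)) refl M p³ (s ^ℚ m) p)))
      (m*[q-s]*s^m≤q^m-s^m 0≤s s≤q s≤1 m)

    y : ℚ
    y = ℤ.+ 5 / 8 * p³

    0≤y : 0ℚ ≤ y
    0≤y = 0≤-* (ℚ.nonNegative⁻¹ (ℤ.+ 5 / 8)) 0≤p³

    q≤s*[1+2y] : q ≤ s * (1ℚ + (y + y))
    q≤s*[1+2y] = ≤-by _ _
      (p³ * (1ℚ - p) * (ℤ.+ 5 / 4) * (ℤ.+ 19 / 100 * (ℤ.+ 7 / 10 - p) + ℤ.+ 67 / 1000 + p * (ℤ.+ 7 / 10 - p) * (ℤ.+ 17 / 10 + p)))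
      (0≤-* (0≤-* (0≤-* 0≤p³ 0≤1-p) (ℚ.nonNegative⁻¹ (ℤ.+ 5 / 4)))
            (0≤-+ (0≤-+ (0≤-* (ℚ.nonNegative⁻¹ (ℤ.+ 19 / 100)) 0≤7/10-p) (ℚ.nonNegative⁻¹ (ℤ.+ 67 / 1000)))
                  (0≤-* (0≤-* 0≤p 0≤7/10-p) (0≤-+ (ℚ.nonNegative⁻¹ (ℤ.+ 17 / 10)) 0≤p))))
      (solve 1 (λ p → let p³ = p :* (p :* (p :* con 1ℚ))
                          y  = con (ℤ.+ 5 / 8) :* p³
                          c₇ = con (ℤ.+ 7 / 10)
                      in (con 1ℚ :- p :* p) :* (con 1ℚ :- p :* p) :* (con 1ℚ :+ (y :+ y))
                         :- (con 1ℚ :- con (ℕ→ℚ 2) :* (p :* (p :* con 1ℚ)) :+ p³)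
                      := p³ :* (con 1ℚ :- p) :* con (ℤ.+ 5 / 4)
                         :* (con (ℤ.+ 19 / 100) :* (c₇ :- p) :+ con (ℤ.+ 67 / 1000) :+ p :* (c₇ :- p) :* (con (ℤ.+ 17 / 10) :+ p)))
        refl p)
      where
      0≤7/10-p : 0ℚ ≤ ℤ.+ 7 / 10 - p
      0≤7/10-p = a≤b⇒0≤b-a p≤7/10

    -- (1 + 2y)^m ≤ 1 / (1 - m y)² and m y ≤ 5/8.
    [1+2y]^m≤64/9 : (1ℚ + (y + y)) ^ℚ m ≤ ℤ.+ 64 / 9
    [1+2y]^m≤64/9 = ≤-by _ _
      (ℤ.+ 64 / 9 * (1ℚ - Z * ((1ℚ - M * y) * (1ℚ - M * y))) + ℤ.+ 64 / 9 * Z * (ℤ.+ 3 / 4 * e + e * e))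
      (0≤-+ (0≤-* (ℚ.nonNegative⁻¹ (ℤ.+ 64 / 9)) (a≤b⇒0≤b-a ([1+2y]^m*[1-my]²≤1 0≤y m My≤1)))
            (0≤-* (0≤-* (ℚ.nonNegative⁻¹ (ℤ.+ 64 / 9)) (0≤a^n _ m (0≤-+ 0≤1 (0≤-+ 0≤y 0≤y))))
                  (0≤-+ (0≤-* (ℚ.nonNegative⁻¹ (ℤ.+ 3 / 4)) 0≤e) (0≤-* 0≤e 0≤e))))
      (solve 3 (λ Z M p³ → let c = con (ℤ.+ 64 / 9)
                               y = con (ℤ.+ 5 / 8) :* p³
                               e = con (ℤ.+ 5 / 8) :* (con 1ℚ :- M :* p³)
                           in c :- Z := c :* (con 1ℚ :- Z :* ((con 1ℚ :- M :* y) :* (con 1ℚ :- M :* y)))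
                                        :+ c :* Z :* (con (ℤ.+ 3 / 4) :* e :+ e :* e))
        refl Z M p³)
      where
      Z = (1ℚ + (y + y)) ^ℚ m
      e = ℤ.+ 5 / 8 * (1ℚ - M * p³)
      0≤e : 0ℚ ≤ e
      0≤e = 0≤-* (ℚ.nonNegative⁻¹ (ℤ.+ 5 / 8)) (a≤b⇒0≤b-a mp³≤1)
      My≤1 : M * y ≤ 1ℚ
      My≤1 = ≤-by _ _ (e + ℤ.+ 3 / 8) (0≤-+ 0≤e (ℚ.nonNegative⁻¹ (ℤ.+ 3 / 8)))
        (solve 2 (λ M p³ → con 1ℚ :- M :* (con (ℤ.+ 5 / 8) :* p³) := con (ℤ.+ 5 / 8) :* (con 1ℚ :- M :* p³) :+ con (ℤ.+ 3 / 8))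
          refl M p³)

    q^m≤s^m*64/9 : q ^ℚ m ≤ s ^ℚ m * (ℤ.+ 64 / 9)
    q^m≤s^m*64/9 = ℚ.≤-trans
      (subst (q ^ℚ m ≤_) ([a*b]^n≡a^n*b^n s (1ℚ + (y + y)) m) (^-mono-≤ m 0≤q q≤s*[1+2y]))
      (*-mono-≤-nonNeg (0≤a^n s m 0≤s) (0≤a^n _ m (0≤-+ 0≤1 (0≤-+ 0≤y 0≤y))) ℚ.≤-refl [1+2y]^m≤64/9)

    q^m-s^m≤8*mp³*s^m : q ^ℚ m - s ^ℚ m ≤ ℕ→ℚ 8 * (M * p³ * s ^ℚ m)
    q^m-s^m≤8*mp³*s^m = ℚ.≤-trans (q^m-s^m≤q^m*mp³ m) (ℚ.≤-trans
      (*-mono-≤-nonNeg (0≤a^n q m 0≤q) (0≤-* (0≤ℕ→ℚ m) 0≤p³) q^m≤s^m*64/9 ℚ.≤-refl)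
      (≤-by _ _ (ℤ.+ 8 / 9 * (M * p³) * s ^ℚ m)
        (0≤-* (0≤-* (ℚ.nonNegative⁻¹ (ℤ.+ 8 / 9)) (0≤-* (0≤ℕ→ℚ m) 0≤p³)) (0≤a^n s m 0≤s))
        (solve 3 (λ S M p³ → con (ℕ→ℚ 8) :* (M :* p³ :* S) :- S :* con (ℤ.+ 64 / 9) :* (M :* p³)
                            := con (ℤ.+ 8 / 9) :* (M :* p³) :* S) refl (s ^ℚ m) M p³)))

module BinomialSize (n : ℕ) (3≤n : 3 ℕ.≤ n) where

  N j : ℚ
  N = ℕ→ℚ n
  j = ℕ→ℚ (n ℕ.∸ 3)

  0≤j : 0ℚ ≤ j
  0≤j = 0≤ℕ→ℚ (n ℕ.∸ 3)

  N≡3+j : N ≡ ℕ→ℚ 3 + j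
  N≡3+j = ℕ→ℚ-split 3≤n

  0≤3+j : 0ℚ ≤ ℕ→ℚ 3 + j
  0≤3+j = 0≤-+ (0≤ℕ→ℚ 3) 0≤j

  ⅓N²≤binom-2 : ℤ.+ 1 / 3 * N ^ℚ 2 ≤ binom n 2
  ⅓N²≤binom-2 = ≤-by _ _ (ℤ.+ 1 / 6 * (ℕ→ℚ 3 + j) * j) (0≤-* (0≤-* (ℚ.nonNegative⁻¹ (ℤ.+ 1 / 6)) 0≤3+j) 0≤j) (begin
    binom n 2 - ℤ.+ 1 / 3 * N ^ℚ 2         ≡⟨ cong (_- ℤ.+ 1 / 3 * N ^ℚ 2) (binom-2≡ n) ⟩
    ½ * (N * (N - 1ℚ)) - ℤ.+ 1 / 3 * N ^ℚ 2 ≡⟨ cong (λ N → ½ * (N * (N - 1ℚ)) - ℤ.+ 1 / 3 * N ^ℚ 2) N≡3+j ⟩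
    _                                       ≡⟨ solve 1 (λ j → let N = con (ℕ→ℚ 3) :+ j in
                                                 con ½ :* (N :* (N :- con 1ℚ)) :- con (ℤ.+ 1 / 3) :* (N :* (N :* con 1ℚ))
                                                 := con (ℤ.+ 1 / 6) :* N :* j) refl j ⟩
    ℤ.+ 1 / 6 * (ℕ→ℚ 3 + j) * j             ∎)

  binom-2≤N² : binom n 2 ≤ N ^ℚ 2
  binom-2≤N² = ≤-by _ _ (½ * N * (N + 1ℚ)) (0≤-* (0≤-* (ℚ.nonNegative⁻¹ ½) (0≤ℕ→ℚ n)) (0≤-+ (0≤ℕ→ℚ n) 0≤1))
    (trans (cong (λ b → N ^ℚ 2 - b) (binom-2≡ n))
      (solve 1 (λ N → N :* (N :* con 1ℚ) :- con ½ :* (N :* (N :- con 1ℚ)) := con ½ :* N :* (N :+ con 1ℚ)) refl N))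

  2/9*N³≤6*binom-3 : ℤ.+ 2 / 9 * N ^ℚ 3 ≤ ℕ→ℚ 6 * binom n 3
  2/9*N³≤6*binom-3 = ≤-by _ _ ((ℕ→ℚ 3 + j) * j * (ℤ.+ 5 / 3 + ℤ.+ 7 / 9 * j))
    (0≤-* (0≤-* 0≤3+j 0≤j) (0≤-+ (ℚ.nonNegative⁻¹ (ℤ.+ 5 / 3)) (0≤-* (ℚ.nonNegative⁻¹ (ℤ.+ 7 / 9)) 0≤j))) (begin
    ℕ→ℚ 6 * binom n 3 - ℤ.+ 2 / 9 * N ^ℚ 3
      ≡⟨ cong (λ b → ℕ→ℚ 6 * b - ℤ.+ 2 / 9 * N ^ℚ 3) (binom-3≡ n) ⟩
    ℕ→ℚ 6 * (ℤ.+ 1 / 6 * (N * (N - 1ℚ) * (N - ℕ→ℚ 2))) - ℤ.+ 2 / 9 * N ^ℚ 3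
      ≡⟨ cong (λ N → ℕ→ℚ 6 * (ℤ.+ 1 / 6 * (N * (N - 1ℚ) * (N - ℕ→ℚ 2))) - ℤ.+ 2 / 9 * N ^ℚ 3) N≡3+j ⟩
    _ ≡⟨ solve 1 (λ j → let N = con (ℕ→ℚ 3) :+ j in
           con (ℕ→ℚ 6) :* (con (ℤ.+ 1 / 6) :* (N :* (N :- con 1ℚ) :* (N :- con (ℕ→ℚ 2))))
             :- con (ℤ.+ 2 / 9) :* (N :* (N :* (N :* con 1ℚ)))
           := N :* j :* (con (ℤ.+ 5 / 3) :+ con (ℤ.+ 7 / 9) :* j)) refl j ⟩
    (ℕ→ℚ 3 + j) * j * (ℤ.+ 5 / 3 + ℤ.+ 7 / 9 * j) ∎)

  6*binom-3≤N³ : ℕ→ℚ 6 * binom n 3 ≤ N ^ℚ 3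
  6*binom-3≤N³ = ≤-by _ _ ((ℕ→ℚ 3 + j) * (ℕ→ℚ 7 + ℕ→ℚ 3 * j))
    (0≤-* 0≤3+j (0≤-+ (0≤ℕ→ℚ 7) (0≤-* (0≤ℕ→ℚ 3) 0≤j))) (begin
    N ^ℚ 3 - ℕ→ℚ 6 * binom n 3
      ≡⟨ cong (λ b → N ^ℚ 3 - ℕ→ℚ 6 * b) (binom-3≡ n) ⟩
    N ^ℚ 3 - ℕ→ℚ 6 * (ℤ.+ 1 / 6 * (N * (N - 1ℚ) * (N - ℕ→ℚ 2)))
      ≡⟨ cong (λ N → N ^ℚ 3 - ℕ→ℚ 6 * (ℤ.+ 1 / 6 * (N * (N - 1ℚ) * (N - ℕ→ℚ 2)))) N≡3+j ⟩
    _ ≡⟨ solve 1 (λ j → let N = con (ℕ→ℚ 3) :+ j in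
           N :* (N :* (N :* con 1ℚ)) :- con (ℕ→ℚ 6) :* (con (ℤ.+ 1 / 6) :* (N :* (N :- con 1ℚ) :* (N :- con (ℕ→ℚ 2))))
           := N :* (con (ℕ→ℚ 7) :+ con (ℕ→ℚ 3) :* j)) refl j ⟩
    (ℕ→ℚ 3 + j) * (ℕ→ℚ 7 + ℕ→ℚ 3 * j) ∎)

sum-lower : {c a b x y X Y : ℚ} → 0ℚ ≤ x → 0ℚ ≤ y → c ≤ a → c ≤ b → a * x ≤ X → b * y ≤ Y → c * (x + y) ≤ X + Y
sum-lower {c} {a} {b} {x} {y} {X} {Y} 0≤x 0≤y c≤a c≤b ax≤X by≤Y = ≤-by _ _
  ((X - a * x) + (a - c) * x + (Y - b * y) + (b - c) * y)
  (0≤-+ (0≤-+ (0≤-+ (a≤b⇒0≤b-a ax≤X) (0≤-* (a≤b⇒0≤b-a c≤a) 0≤x)) (a≤b⇒0≤b-a by≤Y))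
        (0≤-* (a≤b⇒0≤b-a c≤b) 0≤y))
  (solve 7 (λ c a b x y X Y → X :+ Y :- c :* (x :+ y) := (X :- a :* x) :+ (a :- c) :* x :+ (Y :- b :* y) :+ (b :- c) :* y)
    refl c a b x y X Y)

sum-upper : {Γ x y X Y : ℚ} → X ≤ Γ * x → Y ≤ Γ * y → X + Y ≤ Γ * (x + y)
sum-upper {Γ} {x} {y} {X} {Y} X≤Γx Y≤Γy = subst (X + Y ≤_) (sym (ℚ.*-distribˡ-+ Γ x y)) (ℚ.+-mono-≤ X≤Γx Y≤Γy)

module Variance (n m : ℕ) (p : ℚ) (3≤n : 3 ℕ.≤ n) (0≤p : 0ℚ ≤ p) (p<1 : p < 1ℚ) where
  open AttributeBounds p 0≤p p<1
  open BinomialSize n 3≤n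

  V : ℚ
  V = phat m p * (1ℚ - phat m p)

  gap : ℚ
  gap = q ^ℚ m - s ^ℚ m

  0≤V : 0ℚ ≤ V
  0≤V = subst (0ℚ ≤_) (solve 1 (λ A → A :* (con 1ℚ :- A) := (con 1ℚ :- A) :* (con 1ℚ :- (con 1ℚ :- A))) refl A)
          (0≤-* (0≤a^n _ m 0≤pairMiss) (a≤b⇒0≤b-a (a^n≤1 m 0≤pairMiss pairMiss≤1)))
    where A = pairMiss p ^ℚ m

  s^m≡[1-phat]² : s ^ℚ m ≡ (1ℚ - phat m p) ^ℚ 2
  s^m≡[1-phat]² = trans ([a*b]^n≡a^n*b^n (pairMiss p) (pairMiss p) m)
    (solve 1 (λ A → A :* A := (con 1ℚ :- (con 1ℚ :- A)) :* ((con 1ℚ :- (con 1ℚ :- A)) :* con 1ℚ)) refl (pairMiss p ^ℚ m))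

  VarNE≡binom-2*V+6*binom-3*gap : VarNE n m p ≡ binom n 2 * V + ℕ→ℚ 6 * binom n 3 * gap
  VarNE≡binom-2*V+6*binom-3*gap = begin
    VarNE n m p
      ≡⟨ VarNE≡ n m p ⟩
    binom n 2 * phat m p * (1ℚ - phat m p) + ℕ→ℚ 6 * binom n 3 * (q ^ℚ m - (1ℚ - phat m p) ^ℚ 2)
      ≡⟨ cong₂ (λ a S → a + ℕ→ℚ 6 * binom n 3 * (q ^ℚ m - S))
               (ℚ.*-assoc (binom n 2) (phat m p) (1ℚ - phat m p)) (sym s^m≡[1-phat]²) ⟩
    binom n 2 * V + ℕ→ℚ 6 * binom n 3 * gap ∎
  0≤gap : 0ℚ ≤ gap
  0≤gap = a≤b⇒0≤b-a (^-mono-≤ m 0≤s s≤q)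

  0≤N^ : (k : ℕ) → 0ℚ ≤ N ^ℚ k
  0≤N^ k = 0≤a^n N k (0≤ℕ→ℚ n)

  VarNE-sandwich : (W γ Γ c : ℚ) → 0ℚ ≤ W → 0ℚ ≤ γ → 1ℚ ≤ Γ → c ≤ ℤ.+ 1 / 3 → c ≤ ℤ.+ 2 / 9 * γ →
                   γ * W ≤ gap → gap ≤ Γ * W →
                   c * (N ^ℚ 2 * V + N ^ℚ 3 * W) ≤ VarNE n m p × VarNE n m p ≤ Γ * (N ^ℚ 2 * V + N ^ℚ 3 * W)
  VarNE-sandwich W γ Γ c 0≤W 0≤γ 1≤Γ c≤⅓ c≤2γ/9 γW≤gap gap≤ΓW =
    subst (c * (N ^ℚ 2 * V + N ^ℚ 3 * W) ≤_) (sym VarNE≡binom-2*V+6*binom-3*gap) lower ,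
    subst (_≤ Γ * (N ^ℚ 2 * V + N ^ℚ 3 * W)) (sym VarNE≡binom-2*V+6*binom-3*gap) upper
    where
    lower : c * (N ^ℚ 2 * V + N ^ℚ 3 * W) ≤ binom n 2 * V + ℕ→ℚ 6 * binom n 3 * gap
    lower = sum-lower (0≤-* (0≤N^ 2) 0≤V) (0≤-* (0≤N^ 3) 0≤W) c≤⅓ c≤2γ/9
      (subst (_≤ binom n 2 * V) (ℚ.*-assoc (ℤ.+ 1 / 3) (N ^ℚ 2) V) (a≤b⇒a*c≤b*c 0≤V ⅓N²≤binom-2))
      (subst (_≤ ℕ→ℚ 6 * binom n 3 * gap)
             (solve 4 (λ N³ γ W c → c :* N³ :* (γ :* W) := c :* γ :* (N³ :* W)) refl (N ^ℚ 3) γ W (ℤ.+ 2 / 9))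
             (*-mono-≤-nonNeg (0≤-* (ℚ.nonNegative⁻¹ (ℤ.+ 2 / 9)) (0≤N^ 3)) (0≤-* 0≤γ 0≤W) 2/9*N³≤6*binom-3 γW≤gap))
    upper : binom n 2 * V + ℕ→ℚ 6 * binom n 3 * gap ≤ Γ * (N ^ℚ 2 * V + N ^ℚ 3 * W)
    upper = sum-upper {Γ} {N ^ℚ 2 * V} {N ^ℚ 3 * W}
      (ℚ.≤-trans (a≤b⇒a*c≤b*c 0≤V binom-2≤N²)
                 (subst (_≤ Γ * (N ^ℚ 2 * V)) (ℚ.*-identityˡ _) (a≤b⇒a*c≤b*c (0≤-* (0≤N^ 2) 0≤V) 1≤Γ)))
      (ℚ.≤-trans (a≤b⇒a*c≤b*c 0≤gap 6*binom-3≤N³)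
                 (subst (N ^ℚ 3 * gap ≤_) (solve 3 (λ N³ Γ W → N³ :* (Γ :* W) := Γ :* (N³ :* W)) refl (N ^ℚ 3) Γ W)
                        (*-mono-≤-nonNeg (0≤N^ 3) 0≤gap ℚ.≤-refl gap≤ΓW)))

  magnitude : ℚ
  magnitude = N ^ℚ 2 * phat m p * (1ℚ - phat m p) + N ^ℚ 3 * q ^ℚ m * (1ℚ ⊓ (ℕ→ℚ m * p³))

  magnitude-sparse : ℚ
  magnitude-sparse = N ^ℚ 2 * phat m p * (1ℚ - phat m p) + N ^ℚ 3 * ℕ→ℚ m * p³ * (1ℚ - phat m p) ^ℚ 2

  VarNE≍ : ℤ.+ 1 / 12 * magnitude ≤ VarNE n m p × VarNE n m p ≤ 1ℚ * magnitude
  VarNE≍ = subst (λ b → ℤ.+ 1 / 12 * b ≤ VarNE n m p × VarNE n m p ≤ 1ℚ * b)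
    (solve 5 (λ N² N³ φ Q μ → N² :* (φ :* (con 1ℚ :- φ)) :+ N³ :* (Q :* μ) := N² :* φ :* (con 1ℚ :- φ) :+ N³ :* Q :* μ)
       refl (N ^ℚ 2) (N ^ℚ 3) (phat m p) (q ^ℚ m) (1ℚ ⊓ (ℕ→ℚ m * p³)))
    (VarNE-sandwich (q ^ℚ m * (1ℚ ⊓ (ℕ→ℚ m * p³))) (ℤ.+ 2 / 5) 1ℚ (ℤ.+ 1 / 12)
       (0≤-* (0≤a^n q m 0≤q) (ℚ.⊓-glb 0≤1 (0≤-* (0≤ℕ→ℚ m) 0≤p³))) (ℚ.nonNegative⁻¹ (ℤ.+ 2 / 5)) ℚ.≤-refl
       (ℚ.≤ᵇ⇒≤ tt) (ℚ.≤ᵇ⇒≤ tt)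
       (2/5*q^m*[1⊓mp³]≤q^m-s^m m) (subst (gap ≤_) (sym (ℚ.*-identityˡ _)) (q^m-s^m≤q^m*[1⊓mp³] m)))

  VarNE≍-sparse : 3 ℕ.≤ m → ℕ→ℚ m * p³ ≤ 1ℚ →
                  ℤ.+ 1 / 15 * magnitude-sparse ≤ VarNE n m p × VarNE n m p ≤ ℕ→ℚ 8 * magnitude-sparse
  VarNE≍-sparse 3≤m mp³≤1 = subst (λ b → ℤ.+ 1 / 15 * b ≤ VarNE n m p × VarNE n m p ≤ ℕ→ℚ 8 * b)
    (trans (cong (λ S → N ^ℚ 2 * V + N ^ℚ 3 * (ℕ→ℚ m * p³ * S)) s^m≡[1-phat]²)
      (solve 6 (λ N² N³ φ M p³ S → N² :* (φ :* (con 1ℚ :- φ)) :+ N³ :* (M :* p³ :* S)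
                                  := N² :* φ :* (con 1ℚ :- φ) :+ N³ :* M :* p³ :* S)
         refl (N ^ℚ 2) (N ^ℚ 3) (phat m p) (ℕ→ℚ m) p³ ((1ℚ - phat m p) ^ℚ 2)))
    (VarNE-sandwich (ℕ→ℚ m * p³ * s ^ℚ m) (ℤ.+ 3 / 10) (ℕ→ℚ 8) (ℤ.+ 1 / 15)
       (0≤-* (0≤-* (0≤ℕ→ℚ m) 0≤p³) (0≤a^n s m 0≤s)) (ℚ.nonNegative⁻¹ (ℤ.+ 3 / 10)) (ℚ.≤ᵇ⇒≤ tt)
       (ℚ.≤ᵇ⇒≤ tt) (ℚ.≤ᵇ⇒≤ tt) 3/10*mp³*s^m≤q^m-s^m q^m-s^m≤8*mp³*s^m)
    where open Sparse m 3≤m mp³≤1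

lemma3p1 :
  ((n m : ℕ) (p : ℚ) → 3 ℕ.≤ n → 3 ℕ.≤ m → 0ℚ < p → p < 1ℚ →
    VarNE n m p ≡
      ℕ→ℚ (n C 2) * phat m p * (1ℚ - phat m p)
      + ℕ→ℚ 6 * ℕ→ℚ (n C 3)
        * ((1ℚ - ℕ→ℚ 2 * p ^ℚ 2 + p ^ℚ 3) ^ℚ m - (1ℚ - phat m p) ^ℚ 2))
  ×
  (∃ λ c → ∃ λ C → 0ℚ < c × c ≤ C ×
    ((n m : ℕ) (p : ℚ) → 3 ℕ.≤ n → 3 ℕ.≤ m → 0ℚ < p → p < 1ℚ →
      let b = ℕ→ℚ n ^ℚ 2 * phat m p * (1ℚ - phat m p)
              + ℕ→ℚ n ^ℚ 3 * (1ℚ - ℕ→ℚ 2 * p ^ℚ 2 + p ^ℚ 3) ^ℚ m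
                * (1ℚ ⊓ (ℕ→ℚ m * p ^ℚ 3))
      in c * b ≤ VarNE n m p × VarNE n m p ≤ C * b))
  ×
  (∃ λ c → ∃ λ C → 0ℚ < c × c ≤ C ×
    ((n m : ℕ) (p : ℚ) → 3 ℕ.≤ n → 3 ℕ.≤ m → 0ℚ < p → p < 1ℚ →
      ℕ→ℚ m * p ^ℚ 3 ≤ 1ℚ →
      let b = ℕ→ℚ n ^ℚ 2 * phat m p * (1ℚ - phat m p)
              + ℕ→ℚ n ^ℚ 3 * ℕ→ℚ m * p ^ℚ 3 * (1ℚ - phat m p) ^ℚ 2
      in c * b ≤ VarNE n m p × VarNE n m p ≤ C * b))
lemma3p1 =
    (λ n m p _ _ _ _ → VarNE≡ n m p)
  , (ℤ.+ 1 / 12 , 1ℚ , ℚ.positive⁻¹ _ , ℚ.≤ᵇ⇒≤ tt ,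
     λ n m p 3≤n _ 0<p p<1 → Variance.VarNE≍ n m p 3≤n (ℚ.<⇒≤ 0<p) p<1)
  , (ℤ.+ 1 / 15 , ℕ→ℚ 8 , ℚ.positive⁻¹ _ , ℚ.≤ᵇ⇒≤ tt ,
     λ n m p 3≤n 3≤m 0<p p<1 → Variance.VarNE≍-sparse n m p 3≤n (ℚ.<⇒≤ 0<p) p<1 3≤m)
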